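{- For every $n\ge 1$, $$\sum_{\sigma\in B_n} \mathrm{sign}(\sigma)\, q^{\mathrm{fmaj}(\sigma)} = [2]_{ -q}[4]_{q}\cdots[2n]_{(-1)^n q}.$$
   Context: $B_n$ is the hyperoctahedral group of signed permutations of $[n]$, a Coxeter group with generators $s_0=[-1,2,\dots,n]$ and $s_i=[1,\dots,i-1,i+1,i,i+2,\dots,n]$ for $1\le i\le n-1$; $\ell$ denotes Coxeter length with respect to these generators and $\mathrm{sign}(\sigma)=(-1)^{\ell(\sigma)}$. $[n]_q=(1-q^n)/(1-q)$. The flag major index is $\mathrm{fmaj}(\sigma)=2\,\mathrm{maj}(\sigma)+\mathrm{neg}(\sigma)$, where $\mathrm{neg}(\sigma)=\#\{i:\sigma(i)<0\}$ and $\mathrm{maj}(\sigma)$ is the major index of $(\sigma(1),\dots,\sigma(n))$ with respect to the order $-1<-2<\cdots<-n<1<\cdots<n$. -}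

module Defs where

open import Data.Nat as ℕ using (ℕ; zero; suc; _≤ᵇ_; _<ᵇ_)
open import Data.Integer as ℤ using (ℤ; +_; -[1+_]; _+_; _*_; -_; ∣_∣)
open import Data.Bool using (Bool; true; false; if_then_else_; _∧_; _∨_; not)
open import Data.List using (List; []; _∷_; map; concatMap; length; upTo; foldr; replicate)
open import Data.Bool.ListAction using (any)
open import Data.List.Properties using (≡-dec)
open import Relation.Nullary.Decidable using (⌊_⌋)

-- Integer polynomials in q as coefficient lists (constant term first).

Poly : Set
Poly = List ℤ

infixl 6 _⊕_
infixl 7 _⊛_ _·ₚ_

_⊕_ : Poly → Poly → Poly
[] ⊕ q = q
(a ∷ p) ⊕ [] = a ∷ p
(a ∷ p) ⊕ (b ∷ q) = (a + b) ∷ (p ⊕ q)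

_·ₚ_ : ℤ → Poly → Poly
c ·ₚ p = map (c *_) p

_⊛_ : Poly → Poly → Poly
[] ⊛ q = []
(a ∷ p) ⊛ q = (a ·ₚ q) ⊕ (+ 0 ∷ (p ⊛ q))

coeff : Poly → ℕ → ℤ
coeff [] k = + 0
coeff (a ∷ p) zero = a
coeff (a ∷ p) (suc k) = coeff p k

infix 4 _≈ₚ_
_≈ₚ_ : Poly → Poly → Set
p ≈ₚ r = ∀ k → coeff p k ≡ coeff r k
  where open import Relation.Binary.PropositionalEquality using (_≡_)

mono : ℤ → ℕ → Poly
mono c k = replicate k (+ 0) Data.List.++ (c ∷ [])
  where import Data.List

Σₚ : List Poly → Poly
Σₚ = foldr _⊕_ []

Πₚ : List Poly → Poly
Πₚ = foldr _⊛_ (+ 1 ∷ [])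

negOnePow : ℕ → ℤ
negOnePow zero = + 1
negOnePow (suc k) = - negOnePow k

-- [m]_{c q} = 1 + (c q) + (c q)^2 + ... + (c q)^{m-1}, for an integer c
qint : ℕ → ℤ → Poly
qint m c = Σₚ (map (λ j → mono (c ℤ.^ j) j) (upTo m))

-- Signed permutations of [n] in window notation [σ(1),…,σ(n)].

insertions : ℤ → List ℤ → List (List ℤ)
insertions x [] = (x ∷ []) ∷ []
insertions x (y ∷ ys) = (x ∷ y ∷ ys) ∷ map (y ∷_) (insertions x ys)

perms : List ℤ → List (List ℤ)
perms [] = [] ∷ []
perms (x ∷ xs) = concatMap (insertions x) (perms xs)

signings : List ℤ → List (List ℤ)
signings [] = [] ∷ []
signings (x ∷ xs) = concatMap (λ ys → (x ∷ ys) ∷ (- x ∷ ys) ∷ []) (signings xs)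

idPerm : ℕ → List ℤ
idPerm n = map (λ i → + suc i) (upTo n)

-- the hyperoctahedral group B_n, as a duplicate-free list of its elements
B : ℕ → List (List ℤ)
B n = concatMap signings (perms (idPerm n))

-- Coxeter length w.r.t. s_0 = [-1,2,…,n], s_i = [1,…,i+1,i,…,n].
-- Right multiplication σ s_0 negates σ(1); σ s_i swaps σ(i), σ(i+1).

negHead : List ℤ → List ℤ
negHead [] = []
negHead (x ∷ xs) = - x ∷ xs

-- swap positions i and i+1 (1-indexed)
swapAt : ℕ → List ℤ → List ℤ
swapAt zero xs = xs
swapAt (suc zero) (x ∷ y ∷ xs) = y ∷ x ∷ xs
swapAt (suc zero) xs = xs
swapAt (suc (suc i)) [] = []
swapAt (suc (suc i)) (x ∷ xs) = x ∷ swapAt (suc i) xs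

actGen : ℕ → List ℤ → List ℤ
actGen zero σ = negHead σ
actGen (suc i) σ = swapAt (suc i) σ

evalWord : ℕ → List ℕ → List ℤ
evalWord n w = foldl' w (idPerm n)
  where
  foldl' : List ℕ → List ℤ → List ℤ
  foldl' [] σ = σ
  foldl' (i ∷ is) σ = foldl' is (actGen i σ)

words : ℕ → ℕ → List (List ℕ)
words n zero = [] ∷ []
words n (suc k) = concatMap (λ i → map (i ∷_) (words n k)) (upTo n)

reachable : ℕ → ℕ → List ℤ → Bool
reachable n k σ = any (λ τ → ⌊ ≡-dec ℤ._≟_ τ σ ⌋) (map (evalWord n) (words n k))

-- least k in [0 … bound] with a word of length k representing σ
-- (Coxeter length; every element of B_n has length ≤ n², so bound n² suffices)
searchLen : ℕ → List ℤ → ℕ → ℕ → ℕ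
searchLen n σ k zero = k
searchLen n σ k (suc fuel) = if reachable n k σ then k else searchLen n σ (suc k) fuel

coxLen : ℕ → List ℤ → ℕ
coxLen n σ = searchLen n σ 0 (n ℕ.* n)

sign : ℕ → List ℤ → ℤ
sign n σ = negOnePow (coxLen n σ)

-- strict order -1 < -2 < ⋯ < -n < 1 < ⋯ < n on nonzero integers
infix 4 _≺_
_≺_ : ℤ → ℤ → Bool
(+ a) ≺ (+ b) = a <ᵇ b
(+ a) ≺ -[1+ b ] = false
-[1+ a ] ≺ (+ b) = true
-[1+ a ] ≺ -[1+ b ] = a <ᵇ b

majFrom : ℕ → List ℤ → ℕ
majFrom p [] = 0
majFrom p (x ∷ []) = 0
majFrom p (x ∷ y ∷ xs) = (if y ≺ x then p else 0) ℕ.+ majFrom (suc p) (y ∷ xs)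

maj : List ℤ → ℕ
maj = majFrom 1

isNeg : ℤ → Bool
isNeg (+ _) = false
isNeg -[1+ _ ] = true

neg : List ℤ → ℕ
neg [] = 0
neg (x ∷ xs) = (if isNeg x then 1 else 0) ℕ.+ neg xs

fmaj : List ℤ → ℕ
fmaj σ = 2 ℕ.* maj σ ℕ.+ neg σ

lhs : ℕ → Poly
lhs n = Σₚ (map (λ σ → mono (sign n σ) (fmaj σ)) (B n))

rhs : ℕ → Poly
rhs n = Πₚ (map (λ i → qint (2 ℕ.* suc i) (negOnePow (suc i))) (upTo n))

{-# OPTIONS --safe #-}
-- Write χ σ = (-1)^(inv |σ| + neg σ). Each Coxeter generator changes
-- inv |σ| + neg σ by exactly one, so sign = χ on B n.
--
-- Let g relabel the entries of B (m+1) by 1 ↦ -(m+1), -1 ↦ m+1 and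
-- ±(a+1) ↦ ±a for a ≥ 1; it permutes B (m+1). If σ does not end in -1, then
-- χ (g σ) = s χ σ and fmaj (g σ) = fmaj σ + 1, where s = (-1)^(m+1). If σ = τ·(-1),
-- then g σ = g τ·(m+1) has the χ and fmaj of g τ ∈ B m, while χ σ = s χ (g τ)
-- and fmaj σ = 2m + 1 + fmaj (g τ). Summing over B (m+1) both before and
-- after relabelling gives (1 - s q) L_{m+1} = (1 - q^(2m+2)) L_m for the
-- left-hand sides. The right-hand sides satisfy the same recurrence, because
-- (1 - s q) [2m+2]_{sq} = 1 - s^(2m+2) q^(2m+2), and 1 - s q can be cancelled.

module Submission where

open import Data.Bool.Base using (Bool; true; false; if_then_else_; T)
open import Data.Empty using (⊥-elim)
open import Data.Integer.Base as ℤ using (ℤ; +_; -[1+_]; 0ℤ; 1ℤ; _+_; _-_; _*_; -_; _^_; ∣_∣)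
import Data.Integer.Properties as ℤ
open import Data.Integer.Tactic.RingSolver using (solve-∀)
open import Data.List.Base using (List; []; _∷_; _++_; _∷ʳ_; [_]; map; length; foldr; concatMap; upTo; applyUpTo)
open import Data.List.Effectful using (module MonadProperties)
import Data.List.Properties as List
open import Data.List.Membership.Propositional using (_∈_; find; lose)
open import Data.List.Membership.Propositional.Properties
  using (∈-map⁺; ∈-map⁻; ∈-upTo⁺; ∈-upTo⁻; ∈-concatMap⁺; ∈-concatMap⁻)
open import Data.List.Relation.Unary.All using (All; []; _∷_)
import Data.List.Relation.Unary.All as All
import Data.List.Relation.Unary.All.Properties as All
open import Data.List.Relation.Unary.AllPairs using (_∷_)
open import Data.List.Relation.Unary.Any using (here; there)
import Data.List.Relation.Unary.Any.Properties as Any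
open import Data.List.Relation.Unary.Unique.Propositional using (Unique)
import Data.List.Relation.Unary.Unique.Propositional.Properties as Unique
open import Data.List.Relation.Binary.Permutation.Propositional
  using (_↭_; prep; swap; ↭-sym; ↭-reflexive; ↭⇒↭ₛ; module PermutationReasoning)
  renaming (refl to ↭-refl; trans to ↭-trans)
import Data.List.Relation.Binary.Permutation.Propositional.Properties as ↭
import Data.List.Relation.Binary.Permutation.Setoid.Properties as ↭ₛ
open import Data.Nat.Base as ℕ using (ℕ; zero; suc; _<ᵇ_; _≤_; _<_; s≤s; z≤n)
import Data.Nat.Properties as ℕ
import Data.Nat.Tactic.RingSolver as ℕ-Solver
open import Data.Product.Base using (Σ; ∃; ∃₂; _×_; _,_; proj₁; proj₂)
open import Data.Sum.Base using (_⊎_; inj₁; inj₂)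
open import Data.Unit.Base using (tt)
open import Function.Base using (_∘_)
open import Relation.Binary.Bundles using (Setoid)
open import Relation.Binary.Definitions using (tri<; tri≈; tri>)
open import Relation.Binary.PropositionalEquality hiding ([_])
import Relation.Binary.Reasoning.Setoid as SetoidReasoning
open import Relation.Nullary.Decidable using (toWitness; fromWitness)

open import Defs

∑ : {A : Set} → List A → (A → ℤ) → ℤ
∑ xs f = foldr _+_ 0ℤ (map f xs)

module _ {A : Set} where

  ∑-++ : ∀ (xs ys : List A) f → ∑ (xs ++ ys) f ≡ ∑ xs f + ∑ ys f
  ∑-++ []       ys f = sym (ℤ.+-identityˡ _)
  ∑-++ (x ∷ xs) ys f = trans (cong (_+_ (f x)) (∑-++ xs ys f)) (sym (ℤ.+-assoc (f x) _ _))

  ∑-cong : ∀ (xs : List A) {f g} → (∀ {x} → x ∈ xs → f x ≡ g x) → ∑ xs f ≡ ∑ xs g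
  ∑-cong []       eq = refl
  ∑-cong (x ∷ xs) eq = cong₂ _+_ (eq (here refl)) (∑-cong xs (eq ∘ there))

  ∑-zero : ∀ (xs : List A) {f} → (∀ {x} → x ∈ xs → f x ≡ 0ℤ) → ∑ xs f ≡ 0ℤ
  ∑-zero []       eq = refl
  ∑-zero (x ∷ xs) eq = cong₂ _+_ (eq (here refl)) (∑-zero xs (eq ∘ there))

  ∑-+ : ∀ (xs : List A) f g → ∑ xs (λ x → f x + g x) ≡ ∑ xs f + ∑ xs g
  ∑-+ []       f g = refl
  ∑-+ (x ∷ xs) f g =
    trans (cong (_+_ (f x + g x)) (∑-+ xs f g)) (middle-swap (f x) (g x) _ _)
    where
    middle-swap : ∀ a b c d → a + b + (c + d) ≡ a + c + (b + d)
    middle-swap = solve-∀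

  ∑-*ˡ : ∀ (xs : List A) c f → ∑ xs (λ x → c * f x) ≡ c * ∑ xs f
  ∑-*ˡ []       c f = sym (ℤ.*-zeroʳ c)
  ∑-*ˡ (x ∷ xs) c f =
    trans (cong (_+_ (c * f x)) (∑-*ˡ xs c f)) (sym (ℤ.*-distribˡ-+ c (f x) _))

  ∑-↭ : ∀ {xs ys : List A} f → xs ↭ ys → ∑ xs f ≡ ∑ ys f
  ∑-↭ f xs↭ys = ↭ₛ.foldr-commMonoid (setoid ℤ) ℤ.+-0-isCommutativeMonoid
    (↭⇒↭ₛ (↭.map⁺ f xs↭ys))

module _ {A B : Set} where

  ∑-map : ∀ (g : A → B) xs f → ∑ (map g xs) f ≡ ∑ xs (f ∘ g)
  ∑-map g xs f = cong (foldr _+_ 0ℤ) (sym (List.map-∘ xs))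

  ∑-concatMap : ∀ (g : A → List B) xs f → ∑ (concatMap g xs) f ≡ ∑ xs (λ x → ∑ (g x) f)
  ∑-concatMap g []       f = refl
  ∑-concatMap g (x ∷ xs) f =
    trans (∑-++ (g x) (concatMap g xs) f) (cong (_+_ (∑ (g x) f)) (∑-concatMap g xs f))

∑-upTo-suc : ∀ m (f : ℕ → ℤ) → ∑ (upTo (suc m)) f ≡ f 0 + ∑ (upTo m) (f ∘ suc)
∑-upTo-suc m f = cong (λ xs → f 0 + foldr _+_ 0ℤ xs)
  (trans (List.map-applyUpTo suc f m) (sym (List.map-applyUpTo (λ i → i) (f ∘ suc) m)))

negOnePow-+ : ∀ a b → negOnePow (a ℕ.+ b) ≡ negOnePow a * negOnePow b
negOnePow-+ zero    b = sym (ℤ.*-identityˡ _)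
negOnePow-+ (suc a) b =
  trans (cong -_ (negOnePow-+ a b)) (ℤ.neg-distribˡ-* (negOnePow a) (negOnePow b))

negOnePow-square : ∀ a → negOnePow a * negOnePow a ≡ 1ℤ
negOnePow-square zero    = refl
negOnePow-square (suc a) = trans (neg-square (negOnePow a)) (negOnePow-square a)
  where
  neg-square : ∀ x → (- x) * (- x) ≡ x * x
  neg-square = solve-∀

negOnePow-^-even : ∀ a b → negOnePow a ^ (2 ℕ.* b) ≡ 1ℤ
negOnePow-^-even a b = begin
  negOnePow a ^ (2 ℕ.* b)
    ≡⟨ ℤ.^-*-assoc (negOnePow a) 2 b ⟨
  (negOnePow a ^ 2) ^ b
    ≡⟨ cong (_^ b) (trans (cong (negOnePow a *_) (ℤ.*-identityʳ _)) (negOnePow-square a)) ⟩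
  1ℤ ^ b
    ≡⟨ ℤ.^-zeroˡ b ⟩
  1ℤ
    ∎
  where open ≡-Reasoning

negOnePow-even : ∀ x → negOnePow (2 ℕ.* x) ≡ 1ℤ
negOnePow-even x = trans (negOnePow-+ x (x ℕ.+ 0))
  (trans (cong (λ y → negOnePow x * negOnePow y) (ℕ.+-identityʳ x)) (negOnePow-square x))

negOnePow-parity : ∀ a b c x → a ℕ.+ b ≡ c ℕ.+ 2 ℕ.* x → negOnePow a ≡ negOnePow c * negOnePow b
negOnePow-parity a b c x a+b≡c+2x = begin
  negOnePow a
    ≡⟨ ℤ.*-identityʳ _ ⟨
  negOnePow a * 1ℤ
    ≡⟨ cong (negOnePow a *_) (negOnePow-square b) ⟨
  negOnePow a * (negOnePow b * negOnePow b)
    ≡⟨ ℤ.*-assoc (negOnePow a) _ _ ⟨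
  negOnePow a * negOnePow b * negOnePow b
    ≡⟨ cong (_* negOnePow b) (negOnePow-+ a b) ⟨
  negOnePow (a ℕ.+ b) * negOnePow b
    ≡⟨ cong (λ e → negOnePow e * negOnePow b) a+b≡c+2x ⟩
  negOnePow (c ℕ.+ 2 ℕ.* x) * negOnePow b
    ≡⟨ cong (_* negOnePow b) (negOnePow-+ c (2 ℕ.* x)) ⟩
  negOnePow c * negOnePow (2 ℕ.* x) * negOnePow b
    ≡⟨ cong (λ y → negOnePow c * y * negOnePow b) (negOnePow-even x) ⟩
  negOnePow c * 1ℤ * negOnePow b
    ≡⟨ cong (_* negOnePow b) (ℤ.*-identityʳ (negOnePow c)) ⟩
  negOnePow c * negOnePow b
    ∎
  where open ≡-Reasoning

-- Coefficient sequences and polynomials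

δ : ℕ → ℕ → ℤ
δ zero    zero    = 1ℤ
δ zero    (suc k) = 0ℤ
δ (suc d) zero    = 0ℤ
δ (suc d) (suc k) = δ d k

shift : ℕ → (ℕ → ℤ) → ℕ → ℤ
shift zero    a k       = a k
shift (suc d) a zero    = 0ℤ
shift (suc d) a (suc k) = shift d a k

shift-cong : ∀ d {a b : ℕ → ℤ} → a ≗ b → shift d a ≗ shift d b
shift-cong zero    eq k       = eq k
shift-cong (suc d) eq zero    = refl
shift-cong (suc d) eq (suc k) = shift-cong d eq k

δ-+ : ∀ d f → δ (d ℕ.+ f) ≗ shift d (δ f)
δ-+ zero    f k       = refl
δ-+ (suc d) f zero    = refl
δ-+ (suc d) f (suc k) = δ-+ d f k

shift-*ˡ : ∀ d c (a : ℕ → ℤ) k → shift d (λ j → c * a j) k ≡ c * shift d a k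
shift-*ˡ zero    c a k       = refl
shift-*ˡ (suc d) c a zero    = sym (ℤ.*-zeroʳ c)
shift-*ˡ (suc d) c a (suc k) = shift-*ˡ d c a k

∑-shift : ∀ {A : Set} (xs : List A) d (f : A → ℕ → ℤ) k →
  ∑ xs (λ x → shift d (f x) k) ≡ shift d (λ j → ∑ xs (λ x → f x j)) k
∑-shift xs zero    f k       = refl
∑-shift xs (suc d) f zero    = ∑-zero xs (λ _ → refl)
∑-shift xs (suc d) f (suc k) = ∑-shift xs d f k

tail : (ℕ → ℤ) → ℕ → ℤ
tail a i = a (suc i)

infixl 7 _✶_

_✶_ : (ℕ → ℤ) → (ℕ → ℤ) → ℕ → ℤ
(a ✶ b) zero    = a 0 * b 0
(a ✶ b) (suc k) = a 0 * b (suc k) + (tail a ✶ b) k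

✶-cong : ∀ {a a′ b b′} → a ≗ a′ → b ≗ b′ → a ✶ b ≗ a′ ✶ b′
✶-cong eqa eqb zero    = cong₂ _*_ (eqa 0) (eqb 0)
✶-cong eqa eqb (suc k) =
  cong₂ _+_ (cong₂ _*_ (eqa 0) (eqb (suc k))) (✶-cong (eqa ∘ suc) eqb k)

✶-zeroˡ : ∀ {a} b → (∀ i → a i ≡ 0ℤ) → ∀ k → (a ✶ b) k ≡ 0ℤ
✶-zeroˡ b eq zero    = trans (cong (_* b 0) (eq 0)) (ℤ.*-zeroˡ (b 0))
✶-zeroˡ b eq (suc k) =
  cong₂ _+_ (trans (cong (_* b (suc k)) (eq 0)) (ℤ.*-zeroˡ (b (suc k)))) (✶-zeroˡ b (eq ∘ suc) k)

✶-distribʳ-+ : ∀ a a′ b k → ((λ i → a i + a′ i) ✶ b) k ≡ (a ✶ b) k + (a′ ✶ b) k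
✶-distribʳ-+ a a′ b zero    = ℤ.*-distribʳ-+ (b 0) (a 0) (a′ 0)
✶-distribʳ-+ a a′ b (suc k) =
  trans (cong₂ _+_ (ℤ.*-distribʳ-+ (b (suc k)) (a 0) (a′ 0)) (✶-distribʳ-+ (tail a) (tail a′) b k))
    (middle-swap (a 0 * b (suc k)) (a′ 0 * b (suc k)) ((tail a ✶ b) k) ((tail a′ ✶ b) k))
  where
  middle-swap : ∀ x y z w → x + y + (z + w) ≡ x + z + (y + w)
  middle-swap = solve-∀

✶-*ˡ : ∀ c a b k → ((λ i → c * a i) ✶ b) k ≡ c * (a ✶ b) k
✶-*ˡ c a b zero    = ℤ.*-assoc c (a 0) (b 0)
✶-*ˡ c a b (suc k) =
  trans (cong₂ _+_ (ℤ.*-assoc c (a 0) (b (suc k))) (✶-*ˡ c (tail a) b k))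
    (sym (ℤ.*-distribˡ-+ c _ _))

✶-suc : ∀ a b k → (a ✶ b) (suc k) ≡ (a ✶ tail b) k + a (suc k) * b 0
✶-suc a b zero    = refl
✶-suc a b (suc k) =
  trans (cong (_+_ (a 0 * b (suc (suc k)))) (✶-suc (tail a) b k))
    (sym (ℤ.+-assoc (a 0 * b (suc (suc k))) ((tail a ✶ tail b) k) (a (suc (suc k)) * b 0)))

✶-comm : ∀ a b k → (a ✶ b) k ≡ (b ✶ a) k
✶-comm a b zero    = ℤ.*-comm (a 0) (b 0)
✶-comm a b (suc k) =
  trans (cong (_+_ (a 0 * b (suc k))) (✶-comm (tail a) b k))
    (trans (swap-sides (a 0) (b (suc k)) _) (sym (✶-suc b a k)))
  where
  swap-sides : ∀ x y z → x * y + z ≡ z + y * x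
  swap-sides = solve-∀

✶-assoc : ∀ a b c k → ((a ✶ b) ✶ c) k ≡ (a ✶ (b ✶ c)) k
✶-assoc a b c zero    = ℤ.*-assoc (a 0) (b 0) (c 0)
✶-assoc a b c (suc k) =
  trans (cong (_+_ (a 0 * b 0 * c (suc k))) tail-step)
    (regroup (a 0) (b 0) (c (suc k)) ((tail b ✶ c) k) ((tail a ✶ (b ✶ c)) k))
  where
  tail-step : (tail (a ✶ b) ✶ c) k ≡ a 0 * (tail b ✶ c) k + (tail a ✶ (b ✶ c)) k
  tail-step = trans (✶-distribʳ-+ (λ i → a 0 * b (suc i)) (tail a ✶ b) c k)
    (cong₂ _+_ (✶-*ˡ (a 0) (tail b) c k) (✶-assoc (tail a) b c k))
  regroup : ∀ x y z u v → x * y * z + (x * u + v) ≡ x * (y * z + u) + v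
  regroup = solve-∀

δ-✶ : ∀ d b → δ d ✶ b ≗ shift d b
δ-✶ zero    b zero    = ℤ.*-identityˡ (b 0)
δ-✶ zero    b (suc k) =
  trans (cong₂ _+_ (ℤ.*-identityˡ (b (suc k))) (✶-zeroˡ b (λ _ → refl) k)) (ℤ.+-identityʳ _)
δ-✶ (suc d) b zero    = ℤ.*-zeroˡ (b 0)
δ-✶ (suc d) b (suc k) =
  trans (cong₂ _+_ (ℤ.*-zeroˡ (b (suc k))) (δ-✶ d b k)) (ℤ.+-identityˡ _)

≈ₚ-setoid : Setoid _ _
≈ₚ-setoid = record
  { Carrier       = Poly
  ; _≈_           = _≈ₚ_
  ; isEquivalence = record
    { refl  = λ _ → refl
    ; sym   = λ eq k → sym (eq k)
    ; trans = λ eq eq′ k → trans (eq k) (eq′ k)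
    }
  }

module ≈ₚ-Reasoning = SetoidReasoning ≈ₚ-setoid

coeff-⊕ : ∀ p r k → coeff (p ⊕ r) k ≡ coeff p k + coeff r k
coeff-⊕ []      r       k       = sym (ℤ.+-identityˡ _)
coeff-⊕ (a ∷ p) []      k       = sym (ℤ.+-identityʳ _)
coeff-⊕ (a ∷ p) (b ∷ r) zero    = refl
coeff-⊕ (a ∷ p) (b ∷ r) (suc k) = coeff-⊕ p r k

coeff-·ₚ : ∀ c p k → coeff (c ·ₚ p) k ≡ c * coeff p k
coeff-·ₚ c []      k       = sym (ℤ.*-zeroʳ c)
coeff-·ₚ c (a ∷ p) zero    = refl
coeff-·ₚ c (a ∷ p) (suc k) = coeff-·ₚ c p k

coeff-mono : ∀ c d k → coeff (mono c d) k ≡ c * δ d k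
coeff-mono c zero    zero    = sym (ℤ.*-identityʳ c)
coeff-mono c zero    (suc k) = sym (ℤ.*-zeroʳ c)
coeff-mono c (suc d) zero    = sym (ℤ.*-zeroʳ c)
coeff-mono c (suc d) (suc k) = coeff-mono c d k

coeff-Σₚ : ∀ ps k → coeff (Σₚ ps) k ≡ ∑ ps (λ p → coeff p k)
coeff-Σₚ []       k = refl
coeff-Σₚ (p ∷ ps) k = trans (coeff-⊕ p (Σₚ ps) k) (cong (_+_ (coeff p k)) (coeff-Σₚ ps k))

coeff-⊛ : ∀ p r → coeff (p ⊛ r) ≗ coeff p ✶ coeff r
coeff-⊛ []      r k       = sym (✶-zeroˡ (coeff r) (λ _ → refl) k)
coeff-⊛ (a ∷ p) r zero    =
  trans (coeff-⊕ (a ·ₚ r) _ zero) (trans (ℤ.+-identityʳ _) (coeff-·ₚ a r zero))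
coeff-⊛ (a ∷ p) r (suc k) =
  trans (coeff-⊕ (a ·ₚ r) _ (suc k)) (cong₂ _+_ (coeff-·ₚ a r (suc k)) (coeff-⊛ p r k))

⊛-congˡ : ∀ p p′ r → p ≈ₚ p′ → p ⊛ r ≈ₚ p′ ⊛ r
⊛-congˡ p p′ r eq k =
  trans (coeff-⊛ p r k) (trans (✶-cong eq (λ _ → refl) k) (sym (coeff-⊛ p′ r k)))

⊛-congʳ : ∀ p r r′ → r ≈ₚ r′ → p ⊛ r ≈ₚ p ⊛ r′
⊛-congʳ p r r′ eq k =
  trans (coeff-⊛ p r k) (trans (✶-cong (λ _ → refl) eq k) (sym (coeff-⊛ p r′ k)))

⊛-comm : ∀ p r → p ⊛ r ≈ₚ r ⊛ p
⊛-comm p r k =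
  trans (coeff-⊛ p r k) (trans (✶-comm (coeff p) (coeff r) k) (sym (coeff-⊛ r p k)))

⊛-assoc : ∀ p r t → (p ⊛ r) ⊛ t ≈ₚ p ⊛ (r ⊛ t)
⊛-assoc p r t k = begin
  coeff ((p ⊛ r) ⊛ t) k                   ≡⟨ coeff-⊛ (p ⊛ r) t k ⟩
  (coeff (p ⊛ r) ✶ coeff t) k             ≡⟨ ✶-cong (coeff-⊛ p r) (λ _ → refl) k ⟩
  ((coeff p ✶ coeff r) ✶ coeff t) k       ≡⟨ ✶-assoc (coeff p) (coeff r) (coeff t) k ⟩
  (coeff p ✶ (coeff r ✶ coeff t)) k       ≡⟨ ✶-cong (λ _ → refl) (coeff-⊛ r t) k ⟨
  (coeff p ✶ coeff (r ⊛ t)) k             ≡⟨ coeff-⊛ p (r ⊛ t) k ⟨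
  coeff (p ⊛ (r ⊛ t)) k                   ∎
  where open ≡-Reasoning

Πₚ-∷ʳ : ∀ ps p → Πₚ (ps ∷ʳ p) ≈ₚ p ⊛ Πₚ ps
Πₚ-∷ʳ []       p k = refl
Πₚ-∷ʳ (r ∷ ps) p   = begin
  r ⊛ Πₚ (ps ∷ʳ p)    ≈⟨ ⊛-congʳ r _ _ (Πₚ-∷ʳ ps p) ⟩
  r ⊛ (p ⊛ Πₚ ps)     ≈⟨ ⊛-assoc r p (Πₚ ps) ⟨
  (r ⊛ p) ⊛ Πₚ ps     ≈⟨ ⊛-congˡ (r ⊛ p) (p ⊛ r) (Πₚ ps) (⊛-comm r p) ⟩
  (p ⊛ r) ⊛ Πₚ ps     ≈⟨ ⊛-assoc p r (Πₚ ps) ⟩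
  p ⊛ (r ⊛ Πₚ ps)     ∎
  where open ≈ₚ-Reasoning

one-minus : ℤ → ℕ → Poly
one-minus c d = mono 1ℤ 0 ⊕ mono (- c) d

coeff-one-minus : ∀ c d k → coeff (one-minus c d) k ≡ δ 0 k - c * δ d k
coeff-one-minus c d k = trans (coeff-⊕ (mono 1ℤ 0) (mono (- c) d) k)
  (cong₂ _+_ (trans (coeff-mono 1ℤ 0 k) (ℤ.*-identityˡ _))
             (trans (coeff-mono (- c) d k) (sym (ℤ.neg-distribˡ-* c (δ d k)))))

coeff-one-minus-⊛ : ∀ c d p k → coeff (one-minus c d ⊛ p) k ≡ coeff p k - c * shift d (coeff p) k
coeff-one-minus-⊛ c d p k = begin
  coeff (one-minus c d ⊛ p) k
    ≡⟨ coeff-⊛ (one-minus c d) p k ⟩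
  (coeff (one-minus c d) ✶ coeff p) k
    ≡⟨ ✶-cong (coeff-one-minus c d) (λ _ → refl) k ⟩
  ((λ i → δ 0 i - c * δ d i) ✶ coeff p) k
    ≡⟨ ✶-cong (λ i → cong (_+_ (δ 0 i)) (ℤ.neg-distribˡ-* c (δ d i))) (λ _ → refl) k ⟩
  ((λ i → δ 0 i + (- c) * δ d i) ✶ coeff p) k
    ≡⟨ ✶-distribʳ-+ (δ 0) _ (coeff p) k ⟩
  (δ 0 ✶ coeff p) k + ((λ i → (- c) * δ d i) ✶ coeff p) k
    ≡⟨ cong₂ _+_ (δ-✶ 0 (coeff p) k) (✶-*ˡ (- c) (δ d) (coeff p) k) ⟩
  coeff p k + (- c) * (δ d ✶ coeff p) k
    ≡⟨ cong (λ x → coeff p k + (- c) * x) (δ-✶ d (coeff p) k) ⟩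
  coeff p k + (- c) * shift d (coeff p) k
    ≡⟨ cong (_+_ (coeff p k)) (ℤ.neg-distribˡ-* c _) ⟨
  coeff p k - c * shift d (coeff p) k
    ∎
  where open ≡-Reasoning

one-minus-cancelˡ : ∀ c p r → one-minus c 1 ⊛ p ≈ₚ one-minus c 1 ⊛ r → p ≈ₚ r
one-minus-cancelˡ c p r eq = coefficients-agree
  where
  add-back : ∀ v c x → v ≡ v - c * x + c * x
  add-back = solve-∀
  cancel : ∀ x y z w → x ≡ y → z - c * x ≡ w - c * y → z ≡ w
  cancel x y z w refl e =
    trans (add-back z c x) (trans (cong (_+ c * x) e) (sym (add-back w c x)))
  coefficient-equation : ∀ k → coeff p k - c * shift 1 (coeff p) k ≡ coeff r k - c * shift 1 (coeff r) k
  coefficient-equation k =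
    trans (sym (coeff-one-minus-⊛ c 1 p k)) (trans (eq k) (coeff-one-minus-⊛ c 1 r k))
  coefficients-agree : p ≈ₚ r
  coefficients-agree zero    = cancel 0ℤ 0ℤ _ _ refl (coefficient-equation 0)
  coefficients-agree (suc k) = cancel _ _ _ _ (coefficients-agree k) (coefficient-equation (suc k))

-- q-integers and the right-hand side

qintCoeff : ℕ → ℤ → ℕ → ℤ
qintCoeff zero    c k       = 0ℤ
qintCoeff (suc m) c zero    = 1ℤ
qintCoeff (suc m) c (suc k) = c * qintCoeff m c k

coeff-qint : ∀ m c → coeff (qint m c) ≗ qintCoeff m c
coeff-qint m c k = begin
  coeff (qint m c) k
    ≡⟨ coeff-Σₚ (map (λ j → mono (c ^ j) j) (upTo m)) k ⟩
  ∑ (map (λ j → mono (c ^ j) j) (upTo m)) (λ p → coeff p k)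
    ≡⟨ ∑-map (λ j → mono (c ^ j) j) (upTo m) (λ p → coeff p k) ⟩
  ∑ (upTo m) (λ j → coeff (mono (c ^ j) j) k)
    ≡⟨ ∑-cong (upTo m) (λ {j} _ → coeff-mono (c ^ j) j k) ⟩
  ∑ (upTo m) (λ j → c ^ j * δ j k)
    ≡⟨ geometric m k ⟩
  qintCoeff m c k
    ∎
  where
  open ≡-Reasoning
  geometric : ∀ m k → ∑ (upTo m) (λ j → c ^ j * δ j k) ≡ qintCoeff m c k
  geometric zero    k       = refl
  geometric (suc m) zero    = trans (∑-upTo-suc m (λ j → c ^ j * δ j 0))
    (cong (_+_ 1ℤ) (∑-zero (upTo m) (λ {j} _ → ℤ.*-zeroʳ (c ^ suc j))))
  geometric (suc m) (suc k) = begin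
    ∑ (upTo (suc m)) (λ j → c ^ j * δ j (suc k))
      ≡⟨ ∑-upTo-suc m (λ j → c ^ j * δ j (suc k)) ⟩
    0ℤ + ∑ (upTo m) (λ j → c * c ^ j * δ j k)
      ≡⟨ ℤ.+-identityˡ _ ⟩
    ∑ (upTo m) (λ j → c * c ^ j * δ j k)
      ≡⟨ ∑-cong (upTo m) (λ {j} _ → ℤ.*-assoc c (c ^ j) (δ j k)) ⟩
    ∑ (upTo m) (λ j → c * (c ^ j * δ j k))
      ≡⟨ ∑-*ˡ (upTo m) c (λ j → c ^ j * δ j k) ⟩
    c * ∑ (upTo m) (λ j → c ^ j * δ j k)
      ≡⟨ cong (c *_) (geometric m k) ⟩
    c * qintCoeff m c k
      ∎

qintCoeff-suc : ∀ m c k → qintCoeff (suc m) c k ≡ qintCoeff m c k + c ^ m * δ m k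
qintCoeff-suc zero    c zero    = refl
qintCoeff-suc zero    c (suc k) = ℤ.*-zeroʳ c
qintCoeff-suc (suc m) c zero    = sym (trans (cong (_+_ 1ℤ) (ℤ.*-zeroʳ (c ^ suc m))) (ℤ.+-identityʳ 1ℤ))
qintCoeff-suc (suc m) c (suc k) =
  trans (cong (c *_) (qintCoeff-suc m c k))
    (trans (ℤ.*-distribˡ-+ c _ _) (cong (_+_ (c * qintCoeff m c k)) (sym (ℤ.*-assoc c (c ^ m) (δ m k)))))

one-minus-⊛-qint : ∀ M c → one-minus c 1 ⊛ qint M c ≈ₚ one-minus (c ^ M) M
one-minus-⊛-qint M c k = begin
  coeff (one-minus c 1 ⊛ qint M c) k
    ≡⟨ coeff-one-minus-⊛ c 1 (qint M c) k ⟩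
  coeff (qint M c) k - c * shift 1 (coeff (qint M c)) k
    ≡⟨ cong₂ (λ x y → x - c * y) (coeff-qint M c k) (shift-cong 1 (coeff-qint M c) k) ⟩
  qintCoeff M c k - c * shift 1 (qintCoeff M c) k
    ≡⟨ telescope M k ⟩
  δ 0 k - c ^ M * δ M k
    ≡⟨ coeff-one-minus (c ^ M) M k ⟨
  coeff (one-minus (c ^ M) M) k
    ∎
  where
  open ≡-Reasoning
  cancel : ∀ c a b d → c * a - c * (a + b * d) ≡ 0ℤ - c * b * d
  cancel = solve-∀
  telescope : ∀ M k → qintCoeff M c k - c * shift 1 (qintCoeff M c) k ≡ δ 0 k - c ^ M * δ M k
  telescope zero    zero    = cong (λ x → 0ℤ - x) (ℤ.*-zeroʳ c)
  telescope zero    (suc k) = cong (λ x → 0ℤ - x) (ℤ.*-zeroʳ c)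
  telescope (suc m) zero    = cong (λ x → 1ℤ - x) (trans (ℤ.*-zeroʳ c) (sym (ℤ.*-zeroʳ (c ^ suc m))))
  telescope (suc m) (suc k) =
    trans (cong (λ x → c * qintCoeff m c k - c * x) (qintCoeff-suc m c k)) (cancel c _ (c ^ m) (δ m k))

rhsFactor : ℕ → Poly
rhsFactor i = qint (2 ℕ.* suc i) (negOnePow (suc i))

rhs-suc : ∀ m → rhs (suc m) ≈ₚ rhsFactor m ⊛ rhs m
rhs-suc m = begin
  Πₚ (map rhsFactor (upTo (suc m)))          ≡⟨ cong (Πₚ ∘ map rhsFactor) (List.upTo-∷ʳ m) ⟨
  Πₚ (map rhsFactor (upTo m ∷ʳ m))           ≡⟨ cong Πₚ (List.map-++ rhsFactor (upTo m) [ m ]) ⟩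
  Πₚ (map rhsFactor (upTo m) ∷ʳ rhsFactor m) ≈⟨ Πₚ-∷ʳ (map rhsFactor (upTo m)) (rhsFactor m) ⟩
  rhsFactor m ⊛ rhs m                        ∎
  where open ≈ₚ-Reasoning

rhs-recurrence : ∀ m →
  one-minus (negOnePow (suc m)) 1 ⊛ rhs (suc m) ≈ₚ one-minus 1ℤ (2 ℕ.* suc m) ⊛ rhs m
rhs-recurrence m = begin
  one-minus s 1 ⊛ rhs (suc m)
    ≈⟨ ⊛-congʳ (one-minus s 1) (rhs (suc m)) (rhsFactor m ⊛ rhs m) (rhs-suc m) ⟩
  one-minus s 1 ⊛ (rhsFactor m ⊛ rhs m)
    ≈⟨ ⊛-assoc (one-minus s 1) (rhsFactor m) (rhs m) ⟨
  (one-minus s 1 ⊛ rhsFactor m) ⊛ rhs m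
    ≈⟨ ⊛-congˡ (one-minus s 1 ⊛ rhsFactor m) (one-minus (s ^ (2 ℕ.* suc m)) (2 ℕ.* suc m)) (rhs m)
                                            (one-minus-⊛-qint (2 ℕ.* suc m) s) ⟩
  one-minus (s ^ (2 ℕ.* suc m)) (2 ℕ.* suc m) ⊛ rhs m
    ≡⟨ cong (λ c → one-minus c (2 ℕ.* suc m) ⊛ rhs m) (negOnePow-^-even (suc m) (suc m)) ⟩
  one-minus 1ℤ (2 ℕ.* suc m) ⊛ rhs m
    ∎
  where
  open ≈ₚ-Reasoning
  s : ℤ
  s = negOnePow (suc m)

-- Lists of signed permutations

module _ {A B C : Set} where

  concatMap-concatMap : ∀ (f : B → List C) (g : A → List B) xs →
                        concatMap f (concatMap g xs) ≡ concatMap (λ x → concatMap f (g x)) xs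
  concatMap-concatMap f g xs = sym (MonadProperties.associative xs g f)

module _ {A B : Set} where

  concatMap⁺ : ∀ (f : A → List B) {xs ys} → xs ↭ ys → concatMap f xs ↭ concatMap f ys
  concatMap⁺ f ↭-refl            = ↭-refl
  concatMap⁺ f (prep x xs↭ys)    = ↭.++⁺ˡ (f x) (concatMap⁺ f xs↭ys)
  concatMap⁺ f (swap x y xs↭ys)  =
    ↭-trans (↭.shifts (f x) (f y)) (↭.++⁺ˡ (f y) (↭.++⁺ˡ (f x) (concatMap⁺ f xs↭ys)))
  concatMap⁺ f (↭-trans p q)     = ↭-trans (concatMap⁺ f p) (concatMap⁺ f q)

  concatMap-cong-↭ : ∀ {f g : A → List B} xs → (∀ x → f x ↭ g x) → concatMap f xs ↭ concatMap g xs
  concatMap-cong-↭ []       f↭g = ↭-refl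
  concatMap-cong-↭ (x ∷ xs) f↭g = ↭.++⁺ (f↭g x) (concatMap-cong-↭ xs f↭g)

  ∈-concatMap-witness : ∀ {y} (f : A → List B) xs → y ∈ concatMap f xs → ∃ λ x → x ∈ xs × y ∈ f x
  ∈-concatMap-witness f xs y∈ = find (∈-concatMap⁻ f {xs} y∈)

  ∈-concatMap-intro : ∀ {y x} (f : A → List B) {xs} → x ∈ xs → y ∈ f x → y ∈ concatMap f xs
  ∈-concatMap-intro f x∈ y∈ = ∈-concatMap⁺ f (lose x∈ y∈)

signedPerms : List ℤ → List (List ℤ)
signedPerms xs = concatMap signings (perms xs)

concatMap-insertions-∷ : ∀ x z (ws : List (List ℤ)) →
  concatMap (λ w → insertions x (z ∷ w)) ws ↭ map (λ w → x ∷ z ∷ w) ws ++ map (z ∷_) (concatMap (insertions x) ws)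
concatMap-insertions-∷ x z []       = ↭-refl
concatMap-insertions-∷ x z (w ∷ ws) = prep (x ∷ z ∷ w) (begin
  map (z ∷_) (insertions x w) ++ concatMap (λ w → insertions x (z ∷ w)) ws
    ↭⟨ ↭.++⁺ˡ (map (z ∷_) (insertions x w)) (concatMap-insertions-∷ x z ws) ⟩
  map (z ∷_) (insertions x w) ++ map (λ w → x ∷ z ∷ w) ws ++ map (z ∷_) (concatMap (insertions x) ws)
    ↭⟨ ↭.shifts (map (z ∷_) (insertions x w)) (map (λ w → x ∷ z ∷ w) ws) ⟩
  map (λ w → x ∷ z ∷ w) ws ++ map (z ∷_) (insertions x w) ++ map (z ∷_) (concatMap (insertions x) ws)
    ≡⟨ cong (map (λ w → x ∷ z ∷ w) ws ++_) (List.map-++ (z ∷_) (insertions x w) (concatMap (insertions x) ws)) ⟨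
  map (λ w → x ∷ z ∷ w) ws ++ map (z ∷_) (concatMap (insertions x) (w ∷ ws))
    ∎)
  where open PermutationReasoning

insertions-insertions-∷ : ∀ x y z q → concatMap (insertions x) (insertions y (z ∷ q)) ↭
  (x ∷ y ∷ z ∷ q) ∷ (y ∷ x ∷ z ∷ q) ∷
    (map (λ w → y ∷ z ∷ w) (insertions x q) ++ map (λ w → x ∷ z ∷ w) (insertions y q) ++
     map (z ∷_) (concatMap (insertions x) (insertions y q)))
insertions-insertions-∷ x y z q = prep _ (prep _ (begin
  map (y ∷_) (map (z ∷_) (insertions x q)) ++ concatMap (insertions x) (map (z ∷_) (insertions y q))
    ≡⟨ cong₂ _++_ (sym (List.map-∘ (insertions x q))) (List.concatMap-map (insertions x) (z ∷_) (insertions y q)) ⟩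
  map (λ w → y ∷ z ∷ w) (insertions x q) ++ concatMap (λ w → insertions x (z ∷ w)) (insertions y q)
    ↭⟨ ↭.++⁺ˡ (map (λ w → y ∷ z ∷ w) (insertions x q)) (concatMap-insertions-∷ x z (insertions y q)) ⟩
  map (λ w → y ∷ z ∷ w) (insertions x q) ++ map (λ w → x ∷ z ∷ w) (insertions y q) ++
    map (z ∷_) (concatMap (insertions x) (insertions y q))
    ∎))
  where open PermutationReasoning

insertions-comm : ∀ x y p → concatMap (insertions x) (insertions y p) ↭ concatMap (insertions y) (insertions x p)
insertions-comm x y []      = swap _ _ ↭-refl
insertions-comm x y (z ∷ q) = begin
  concatMap (insertions x) (insertions y (z ∷ q))
    ↭⟨ insertions-insertions-∷ x y z q ⟩
  (x ∷ y ∷ z ∷ q) ∷ (y ∷ x ∷ z ∷ q) ∷ (Yx ++ Xy ++ map (z ∷_) (concatMap (insertions x) (insertions y q)))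
    ↭⟨ swap _ _ (↭.shifts Yx Xy) ⟩
  (y ∷ x ∷ z ∷ q) ∷ (x ∷ y ∷ z ∷ q) ∷ (Xy ++ Yx ++ map (z ∷_) (concatMap (insertions x) (insertions y q)))
    ↭⟨ prep _ (prep _ (↭.++⁺ˡ Xy (↭.++⁺ˡ Yx (↭.map⁺ (z ∷_) (insertions-comm x y q))))) ⟩
  (y ∷ x ∷ z ∷ q) ∷ (x ∷ y ∷ z ∷ q) ∷ (Xy ++ Yx ++ map (z ∷_) (concatMap (insertions y) (insertions x q)))
    ↭⟨ insertions-insertions-∷ y x z q ⟨
  concatMap (insertions y) (insertions x (z ∷ q))
    ∎
  where
  open PermutationReasoning
  Yx Xy : List (List ℤ)
  Yx = map (λ w → y ∷ z ∷ w) (insertions x q)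
  Xy = map (λ w → x ∷ z ∷ w) (insertions y q)

perms-↭ : ∀ {xs ys} → xs ↭ ys → perms xs ↭ perms ys
perms-↭ ↭-refl                = ↭-refl
perms-↭ (prep x p)            = concatMap⁺ (insertions x) (perms-↭ p)
perms-↭ (swap {xs} {ys} x y p) = begin
  concatMap (insertions x) (concatMap (insertions y) (perms xs))
    ≡⟨ concatMap-concatMap (insertions x) (insertions y) (perms xs) ⟩
  concatMap (λ p → concatMap (insertions x) (insertions y p)) (perms xs)
    ↭⟨ concatMap-cong-↭ (perms xs) (insertions-comm x y) ⟩
  concatMap (λ p → concatMap (insertions y) (insertions x p)) (perms xs)
    ↭⟨ concatMap⁺ (λ p → concatMap (insertions y) (insertions x p)) (perms-↭ p) ⟩
  concatMap (λ p → concatMap (insertions y) (insertions x p)) (perms ys)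
    ≡⟨ concatMap-concatMap (insertions y) (insertions x) (perms ys) ⟨
  concatMap (insertions y) (concatMap (insertions x) (perms ys))
    ∎
  where open PermutationReasoning
perms-↭ (↭-trans p q)         = ↭-trans (perms-↭ p) (perms-↭ q)

signedPerms-↭ : ∀ {xs ys} → xs ↭ ys → signedPerms xs ↭ signedPerms ys
signedPerms-↭ = concatMap⁺ signings ∘ perms-↭

bothSigns : ℤ → List ℤ → List (List ℤ)
bothSigns x ys = (x ∷ ys) ∷ (- x ∷ ys) ∷ []

bothSigns-neg : ∀ x ys → bothSigns (- x) ys ↭ bothSigns x ys
bothSigns-neg x ys rewrite ℤ.neg-involutive x = swap _ _ ↭-refl

signings-∷ : ∀ (z : ℤ) (ws : List (List ℤ)) →
  concatMap signings (map (z ∷_) ws) ≡ concatMap (bothSigns z) (concatMap signings ws)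
signings-∷ z ws =
  trans (List.concatMap-map signings (z ∷_) ws) (sym (concatMap-concatMap (bothSigns z) signings ws))

signings-insertions-neg : ∀ x q → concatMap signings (insertions (- x) q) ↭ concatMap signings (insertions x q)
signings-insertions-neg x []      = ↭.++⁺ʳ [] (↭.++⁺ʳ [] (bothSigns-neg x []))
signings-insertions-neg x (z ∷ q) = ↭.++⁺
  (concatMap-cong-↭ (signings (z ∷ q)) (bothSigns-neg x))
  (begin
    concatMap signings (map (z ∷_) (insertions (- x) q))         ≡⟨ signings-∷ z (insertions (- x) q) ⟩
    concatMap (bothSigns z) (concatMap signings (insertions (- x) q))
      ↭⟨ concatMap⁺ (bothSigns z) (signings-insertions-neg x q) ⟩
    concatMap (bothSigns z) (concatMap signings (insertions x q)) ≡⟨ signings-∷ z (insertions x q) ⟨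
    concatMap signings (map (z ∷_) (insertions x q))             ∎)
  where open PermutationReasoning

signedPerms-neg : ∀ x xs → signedPerms (- x ∷ xs) ↭ signedPerms (x ∷ xs)
signedPerms-neg x xs = begin
  concatMap signings (concatMap (insertions (- x)) (perms xs))
    ≡⟨ concatMap-concatMap signings (insertions (- x)) (perms xs) ⟩
  concatMap (λ p → concatMap signings (insertions (- x) p)) (perms xs)
    ↭⟨ concatMap-cong-↭ (perms xs) (signings-insertions-neg x) ⟩
  concatMap (λ p → concatMap signings (insertions x p)) (perms xs)
    ≡⟨ concatMap-concatMap signings (insertions x) (perms xs) ⟨
  concatMap signings (concatMap (insertions x) (perms xs))
    ∎
  where open PermutationReasoning

Odd : (ℤ → ℤ) → Set
Odd f = ∀ x → f (- x) ≡ - f x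

map-insertions : ∀ (f : ℤ → ℤ) x p → map (map f) (insertions x p) ≡ insertions (f x) (map f p)
map-insertions f x []      = refl
map-insertions f x (z ∷ q) = cong ((f x ∷ f z ∷ map f q) ∷_) (begin
  map (map f) (map (z ∷_) (insertions x q))   ≡⟨ List.map-∘ (insertions x q) ⟨
  map (λ w → f z ∷ map f w) (insertions x q)  ≡⟨ List.map-∘ (insertions x q) ⟩
  map (f z ∷_) (map (map f) (insertions x q)) ≡⟨ cong (map (f z ∷_)) (map-insertions f x q) ⟩
  map (f z ∷_) (insertions (f x) (map f q))   ∎)
  where open ≡-Reasoning

map-concatMap-commute : ∀ {A A′ B C : Set} (f : B → C) (g : A → List B) (h : A′ → List C) {k : A → A′} xs →
                        (∀ x → map f (g x) ≡ h (k x)) → map f (concatMap g xs) ≡ concatMap h (map k xs)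
map-concatMap-commute f g h xs eq =
  trans (List.map-concatMap f g xs) (trans (List.concatMap-cong eq xs) (sym (List.concatMap-map h _ xs)))

map-perms : ∀ (f : ℤ → ℤ) xs → map (map f) (perms xs) ≡ perms (map f xs)
map-perms f []       = refl
map-perms f (x ∷ xs) = trans
  (map-concatMap-commute (map f) (insertions x) (insertions (f x)) (perms xs) (map-insertions f x))
  (cong (concatMap (insertions (f x))) (map-perms f xs))

map-signings : ∀ (f : ℤ → ℤ) → Odd f → ∀ xs → map (map f) (signings xs) ≡ signings (map f xs)
map-signings f odd []       = refl
map-signings f odd (x ∷ xs) = trans
  (map-concatMap-commute (map f) (bothSigns x) (bothSigns (f x)) (signings xs)
    (λ ys → cong (λ y → (f x ∷ map f ys) ∷ (y ∷ map f ys) ∷ []) (odd x)))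
  (cong (concatMap (bothSigns (f x))) (map-signings f odd xs))

map-signedPerms : ∀ (f : ℤ → ℤ) → Odd f → ∀ xs → map (map f) (signedPerms xs) ≡ signedPerms (map f xs)
map-signedPerms f odd xs = trans
  (map-concatMap-commute (map f) signings signings (perms xs) (map-signings f odd))
  (cong (concatMap signings) (map-perms f xs))

∈-insertions⁻ : ∀ {q} x p → q ∈ insertions x p → ∃₂ λ a b → p ≡ a ++ b × q ≡ a ++ x ∷ b
∈-insertions⁻ x []      (here refl) = [] , [] , refl , refl
∈-insertions⁻ x (z ∷ p) (here refl) = [] , z ∷ p , refl , refl
∈-insertions⁻ x (z ∷ p) (there q∈) with ∈-map⁻ (z ∷_) q∈
... | q′ , q′∈ , refl with ∈-insertions⁻ x p q′∈
... | a , b , refl , refl = z ∷ a , b , refl , refl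

∈-signings⇒abs : ∀ {σ} xs → σ ∈ signings xs → map ∣_∣ σ ≡ map ∣_∣ xs
∈-signings⇒abs []       (here refl) = refl
∈-signings⇒abs (x ∷ xs) σ∈ with ∈-concatMap-witness (bothSigns x) (signings xs) σ∈
... | ys , ys∈ , here refl         = cong (∣ x ∣ ∷_) (∈-signings⇒abs xs ys∈)
... | ys , ys∈ , there (here refl) = cong₂ _∷_ (ℤ.∣-i∣≡∣i∣ x) (∈-signings⇒abs xs ys∈)

∈-perms⇒↭ : ∀ {q} xs → q ∈ perms xs → q ↭ xs
∈-perms⇒↭ []       (here refl) = ↭-refl
∈-perms⇒↭ (x ∷ xs) q∈ with ∈-concatMap-witness (insertions x) (perms xs) q∈
... | p , p∈ , q∈′ with ∈-insertions⁻ x p q∈′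
... | a , b , refl , refl = ↭-trans (↭.shift x a b) (prep x (∈-perms⇒↭ xs p∈))

∈-signedPerms⇒abs-↭ : ∀ {σ} xs → σ ∈ signedPerms xs → map ∣_∣ σ ↭ map ∣_∣ xs
∈-signedPerms⇒abs-↭ xs σ∈ with ∈-concatMap-witness signings (perms xs) σ∈
... | q , q∈ , σ∈′ = ↭-trans (↭-reflexive (∈-signings⇒abs q σ∈′)) (↭.map⁺ ∣_∣ (∈-perms⇒↭ xs q∈))

∈-signings-++⁻ : ∀ {σ} x a b → σ ∈ signings (a ++ x ∷ b) →
  ∃₂ λ a′ b′ → Σ ℤ λ y → σ ≡ a′ ++ y ∷ b′ × (y ≡ x ⊎ y ≡ - x) × a′ ++ b′ ∈ signings (a ++ b)
∈-signings-++⁻ x [] b σ∈ with ∈-concatMap-witness (bothSigns x) (signings b) σ∈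
... | ys , ys∈ , here refl         = [] , ys , x , refl , inj₁ refl , ys∈
... | ys , ys∈ , there (here refl) = [] , ys , - x , refl , inj₂ refl , ys∈
∈-signings-++⁻ x (z ∷ a) b σ∈ with ∈-concatMap-witness (bothSigns z) (signings (a ++ x ∷ b)) σ∈
... | ys , ys∈ , z∈ with ∈-signings-++⁻ x a b ys∈
... | a′ , b′ , y , refl , y≡±x , a′b′∈ with z∈
... | here refl         = z ∷ a′ , b′ , y , refl , y≡±x ,
                          ∈-concatMap-intro (bothSigns z) a′b′∈ (here refl)
... | there (here refl) = - z ∷ a′ , b′ , y , refl , y≡±x ,
                          ∈-concatMap-intro (bothSigns z) a′b′∈ (there (here refl))

∈-signedPerms-∷⁻ : ∀ {σ} x xs → σ ∈ signedPerms (x ∷ xs) →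
  ∃₂ λ a′ b′ → Σ ℤ λ y → σ ≡ a′ ++ y ∷ b′ × (y ≡ x ⊎ y ≡ - x) × a′ ++ b′ ∈ signedPerms xs
∈-signedPerms-∷⁻ x xs σ∈ with ∈-concatMap-witness signings (perms (x ∷ xs)) σ∈
... | q , q∈ , σ∈′ with ∈-concatMap-witness (insertions x) (perms xs) q∈
... | p , p∈ , q∈′ with ∈-insertions⁻ x p q∈′
... | a , b , refl , refl with ∈-signings-++⁻ x a b σ∈′
... | a′ , b′ , y , eq , y≡±x , a′b′∈ = a′ , b′ , y , eq , y≡±x , ∈-concatMap-intro signings p∈ a′b′∈

-- Inversions and the sign character

indicator : Bool → ℕ
indicator b = if b then 1 else 0

countBelow : ℕ → List ℕ → ℕ
countBelow x []       = 0
countBelow x (y ∷ ys) = indicator (y <ᵇ x) ℕ.+ countBelow x ys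

countAbove : ℕ → List ℕ → ℕ
countAbove x []       = 0
countAbove x (y ∷ ys) = indicator (x <ᵇ y) ℕ.+ countAbove x ys

inversions : List ℕ → ℕ
inversions []       = 0
inversions (x ∷ xs) = countBelow x xs ℕ.+ inversions xs

χ : List ℤ → ℤ
χ σ = negOnePow (inversions (map ∣_∣ σ) ℕ.+ neg σ)

<ᵇ-true : ∀ {a b} → a < b → (a <ᵇ b) ≡ true
<ᵇ-true {zero}  {suc b} _         = refl
<ᵇ-true {suc a} {suc b} (s≤s a<b) = <ᵇ-true a<b

<ᵇ-false : ∀ {a b} → b ≤ a → (a <ᵇ b) ≡ false
<ᵇ-false {a}     {zero}  _         = refl
<ᵇ-false {suc a} {suc b} (s≤s b≤a) = <ᵇ-false b≤a

neg-++ : ∀ xs ys → neg (xs ++ ys) ≡ neg xs ℕ.+ neg ys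
neg-++ []       ys = refl
neg-++ (x ∷ xs) ys =
  trans (cong (indicator (isNeg x) ℕ.+_) (neg-++ xs ys)) (sym (ℕ.+-assoc (indicator (isNeg x)) _ _))

countBelow-++ : ∀ x xs ys → countBelow x (xs ++ ys) ≡ countBelow x xs ℕ.+ countBelow x ys
countBelow-++ x []       ys = refl
countBelow-++ x (y ∷ xs) ys =
  trans (cong (indicator (y <ᵇ x) ℕ.+_) (countBelow-++ x xs ys)) (sym (ℕ.+-assoc (indicator (y <ᵇ x)) _ _))

countAbove-++ : ∀ x xs ys → countAbove x (xs ++ ys) ≡ countAbove x xs ℕ.+ countAbove x ys
countAbove-++ x []       ys = refl
countAbove-++ x (y ∷ xs) ys =
  trans (cong (indicator (x <ᵇ y) ℕ.+_) (countAbove-++ x xs ys)) (sym (ℕ.+-assoc (indicator (x <ᵇ y)) _ _))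

inversions-insert : ∀ xs x ys →
  inversions (xs ++ x ∷ ys) ≡ inversions (xs ++ ys) ℕ.+ (countAbove x xs ℕ.+ countBelow x ys)
inversions-insert []       x ys = ℕ.+-comm (countBelow x ys) (inversions ys)
inversions-insert (z ∷ xs) x ys = begin
  below (xs ++ x ∷ ys) ℕ.+ inversions (xs ++ x ∷ ys)
    ≡⟨ cong₂ ℕ._+_ (countBelow-++ z xs (x ∷ ys)) (inversions-insert xs x ys) ⟩
  below xs ℕ.+ (i ℕ.+ below ys) ℕ.+ (inversions (xs ++ ys) ℕ.+ (countAbove x xs ℕ.+ countBelow x ys))
    ≡⟨ regroup (below xs) i (below ys) (inversions (xs ++ ys)) (countAbove x xs) (countBelow x ys) ⟩
  below xs ℕ.+ below ys ℕ.+ inversions (xs ++ ys) ℕ.+ (i ℕ.+ countAbove x xs ℕ.+ countBelow x ys)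
    ≡⟨ cong (λ c → c ℕ.+ inversions (xs ++ ys) ℕ.+ (i ℕ.+ countAbove x xs ℕ.+ countBelow x ys)) (countBelow-++ z xs ys) ⟨
  below (xs ++ ys) ℕ.+ inversions (xs ++ ys) ℕ.+ (i ℕ.+ countAbove x xs ℕ.+ countBelow x ys)
    ∎
  where
  open ≡-Reasoning
  below : List ℕ → ℕ
  below = countBelow z
  i : ℕ
  i = indicator (x <ᵇ z)
  regroup : ∀ a i b v c d → a ℕ.+ (i ℕ.+ b) ℕ.+ (v ℕ.+ (c ℕ.+ d)) ≡ a ℕ.+ b ℕ.+ v ℕ.+ (i ℕ.+ c ℕ.+ d)
  regroup = ℕ-Solver.solve-∀

inversions-∷ʳ : ∀ xs x → inversions (xs ∷ʳ x) ≡ inversions xs ℕ.+ countAbove x xs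
inversions-∷ʳ xs x = trans (inversions-insert xs x [])
  (cong₂ ℕ._+_ (cong inversions (List.++-identityʳ xs)) (ℕ.+-identityʳ (countAbove x xs)))

inversions-swap : ∀ xs {a b} ys → a < b → inversions (xs ++ b ∷ a ∷ ys) ≡ suc (inversions (xs ++ a ∷ b ∷ ys))
inversions-swap xs {a} {b} ys a<b = begin
  inversions (xs ++ b ∷ a ∷ ys)
    ≡⟨ cong inversions (List.++-assoc xs [ b ] (a ∷ ys)) ⟨
  inversions ((xs ∷ʳ b) ++ a ∷ ys)
    ≡⟨ inversions-insert (xs ∷ʳ b) a ys ⟩
  inversions ((xs ∷ʳ b) ++ ys) ℕ.+ (countAbove a (xs ∷ʳ b) ℕ.+ countBelow a ys)
    ≡⟨ cong₂ (λ u v → inversions u ℕ.+ (v ℕ.+ countBelow a ys)) (List.++-assoc xs [ b ] ys) (countAbove-++ a xs [ b ]) ⟩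
  I ℕ.+ (countAbove a xs ℕ.+ (indicator (a <ᵇ b) ℕ.+ 0) ℕ.+ countBelow a ys)
    ≡⟨ cong (λ t → I ℕ.+ (countAbove a xs ℕ.+ (indicator t ℕ.+ 0) ℕ.+ countBelow a ys)) (<ᵇ-true a<b) ⟩
  I ℕ.+ (countAbove a xs ℕ.+ 1 ℕ.+ countBelow a ys)
    ≡⟨ regroup I (countAbove a xs) (countBelow a ys) ⟩
  suc (I ℕ.+ (countAbove a xs ℕ.+ (0 ℕ.+ countBelow a ys)))
    ≡⟨ cong (λ t → suc (I ℕ.+ (countAbove a xs ℕ.+ (indicator t ℕ.+ countBelow a ys)))) (<ᵇ-false (ℕ.<⇒≤ a<b)) ⟨
  suc (I ℕ.+ (countAbove a xs ℕ.+ countBelow a (b ∷ ys)))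
    ≡⟨ cong suc (inversions-insert xs a (b ∷ ys)) ⟨
  suc (inversions (xs ++ a ∷ b ∷ ys))
    ∎
  where
  open ≡-Reasoning
  I : ℕ
  I = inversions (xs ++ b ∷ ys)
  regroup : ∀ i c d → i ℕ.+ (c ℕ.+ 1 ℕ.+ d) ≡ suc (i ℕ.+ (c ℕ.+ (0 ℕ.+ d)))
  regroup = ℕ-Solver.solve-∀

neg-swap : ∀ xs a b ys → neg (xs ++ b ∷ a ∷ ys) ≡ neg (xs ++ a ∷ b ∷ ys)
neg-swap []       a b ys = exchange (indicator (isNeg b)) (indicator (isNeg a)) (neg ys)
  where
  exchange : ∀ x y z → x ℕ.+ (y ℕ.+ z) ≡ y ℕ.+ (x ℕ.+ z)
  exchange = ℕ-Solver.solve-∀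
neg-swap (x ∷ xs) a b ys = cong (indicator (isNeg x) ℕ.+_) (neg-swap xs a b ys)

χ-flip : ∀ σ τ → inversions (map ∣_∣ τ) ≡ suc (inversions (map ∣_∣ σ)) → neg τ ≡ neg σ → χ τ ≡ - χ σ
χ-flip σ τ inv≡ neg≡ = cong negOnePow (cong₂ ℕ._+_ inv≡ neg≡)

χ-neg-head : ∀ x σ → ∣ x ∣ ≢ 0 → χ (- x ∷ σ) ≡ - χ (x ∷ σ)
χ-neg-head (+ zero)  σ x≢0 = ⊥-elim (x≢0 refl)
χ-neg-head (+ suc a) σ x≢0 =
  cong negOnePow (ℕ.+-suc (countBelow (suc a) (map ∣_∣ σ) ℕ.+ inversions (map ∣_∣ σ)) (neg σ))
χ-neg-head -[1+ a ]  σ x≢0 = trans (sym (ℤ.neg-involutive (χ (+ suc a ∷ σ))))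
  (cong -_ (sym (χ-neg-head (+ suc a) σ (λ ()))))

χ-swap-< : ∀ xs a b ys → ∣ a ∣ < ∣ b ∣ → χ (xs ++ b ∷ a ∷ ys) ≡ - χ (xs ++ a ∷ b ∷ ys)
χ-swap-< xs a b ys ∣a∣<∣b∣ = χ-flip (xs ++ a ∷ b ∷ ys) (xs ++ b ∷ a ∷ ys) abs-inversions (neg-swap xs a b ys)
  where
  abs-inversions : inversions (map ∣_∣ (xs ++ b ∷ a ∷ ys)) ≡ suc (inversions (map ∣_∣ (xs ++ a ∷ b ∷ ys)))
  abs-inversions = begin
    inversions (map ∣_∣ (xs ++ b ∷ a ∷ ys))
      ≡⟨ cong inversions (List.map-++ ∣_∣ xs (b ∷ a ∷ ys)) ⟩
    inversions (map ∣_∣ xs ++ ∣ b ∣ ∷ ∣ a ∣ ∷ map ∣_∣ ys)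
      ≡⟨ inversions-swap (map ∣_∣ xs) (map ∣_∣ ys) ∣a∣<∣b∣ ⟩
    suc (inversions (map ∣_∣ xs ++ ∣ a ∣ ∷ ∣ b ∣ ∷ map ∣_∣ ys))
      ≡⟨ cong (suc ∘ inversions) (List.map-++ ∣_∣ xs (a ∷ b ∷ ys)) ⟨
    suc (inversions (map ∣_∣ (xs ++ a ∷ b ∷ ys)))
      ∎
    where open ≡-Reasoning

χ-swap : ∀ xs a b ys → ∣ a ∣ ≢ ∣ b ∣ → χ (xs ++ b ∷ a ∷ ys) ≡ - χ (xs ++ a ∷ b ∷ ys)
χ-swap xs a b ys ∣a∣≢∣b∣ with ℕ.<-cmp ∣ a ∣ ∣ b ∣
... | tri< ∣a∣<∣b∣ _ _ = χ-swap-< xs a b ys ∣a∣<∣b∣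
... | tri≈ _ ∣a∣≡∣b∣ _ = ⊥-elim (∣a∣≢∣b∣ ∣a∣≡∣b∣)
... | tri> _ _ ∣b∣<∣a∣ =
  trans (sym (ℤ.neg-involutive _)) (cong -_ (sym (χ-swap-< xs b a ys ∣b∣<∣a∣)))

AbsPerm : ℕ → List ℤ → Set
AbsPerm n σ = map ∣_∣ σ ↭ map ∣_∣ (idPerm n)

abs-idPerm : ∀ n → map ∣_∣ (idPerm n) ≡ map suc (upTo n)
abs-idPerm n = sym (List.map-∘ (upTo n))

AbsPerm-length : ∀ {n σ} → AbsPerm n σ → length σ ≡ n
AbsPerm-length {n} {σ} p = begin
  length σ                  ≡⟨ List.length-map ∣_∣ σ ⟨
  length (map ∣_∣ σ)        ≡⟨ ↭.↭-length p ⟩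
  length (map ∣_∣ (idPerm n)) ≡⟨ List.length-map ∣_∣ (idPerm n) ⟩
  length (idPerm n)         ≡⟨ List.length-map (λ i → + suc i) (upTo n) ⟩
  length (upTo n)           ≡⟨ List.length-upTo n ⟩
  n                         ∎
  where open ≡-Reasoning

AbsPerm-unique : ∀ {n σ} → AbsPerm n σ → Unique (map ∣_∣ σ)
AbsPerm-unique {n} p = ↭ₛ.Unique-resp-↭ (setoid ℕ) (↭⇒↭ₛ (↭-sym p))
  (subst Unique (sym (abs-idPerm n)) (Unique.map⁺ ℕ.suc-injective (Unique.upTo⁺ n)))

AbsPerm-nonzero : ∀ {n σ} → AbsPerm n σ → All (λ x → ∣ x ∣ ≢ 0) σ
AbsPerm-nonzero {n} p = All.map⁻ (↭.All-resp-↭ (↭-sym p)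
  (subst (All (_≢ 0)) (sym (abs-idPerm n)) (All.map⁺ (All.universal (λ _ ()) (upTo n)))))

adjacent-distinct : ∀ {A : Set} xs {a b : A} ys → Unique (xs ++ a ∷ b ∷ ys) → a ≢ b
adjacent-distinct []       ys ((a≢b ∷ _) ∷ _) = a≢b
adjacent-distinct (x ∷ xs) ys (_ ∷ u)         = adjacent-distinct xs ys u

split-adjacent : ∀ j (σ : List ℤ) → suc j < length σ →
  ∃₂ λ xs ys → Σ ℤ λ a → Σ ℤ λ b → σ ≡ xs ++ a ∷ b ∷ ys × length xs ≡ j
split-adjacent zero    (a ∷ b ∷ ys) _         = [] , ys , a , b , refl , refl
split-adjacent zero    (a ∷ [])     (s≤s ())
split-adjacent (suc j) (x ∷ σ)      (s≤s lt) with split-adjacent j σ lt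
... | xs , ys , a , b , refl , refl = x ∷ xs , ys , a , b , refl , refl

swapAt-adjacent : ∀ xs a b ys → swapAt (suc (length xs)) (xs ++ a ∷ b ∷ ys) ≡ xs ++ b ∷ a ∷ ys
swapAt-adjacent []       a b ys = refl
swapAt-adjacent (x ∷ xs) a b ys = cong (x ∷_) (swapAt-adjacent xs a b ys)

abs-swapAt : ∀ i σ → map ∣_∣ (swapAt i σ) ↭ map ∣_∣ σ
abs-swapAt zero                σ            = ↭-refl
abs-swapAt (suc zero)          []           = ↭-refl
abs-swapAt (suc zero)          (x ∷ [])     = ↭-refl
abs-swapAt (suc zero)          (x ∷ y ∷ σ)  = swap ∣ y ∣ ∣ x ∣ ↭-refl
abs-swapAt (suc (suc i))       []           = ↭-refl
abs-swapAt (suc (suc i))       (x ∷ σ)      = prep ∣ x ∣ (abs-swapAt (suc i) σ)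

abs-actGen : ∀ i σ → map ∣_∣ (actGen i σ) ↭ map ∣_∣ σ
abs-actGen zero    []      = ↭-refl
abs-actGen zero    (x ∷ σ) = ↭-reflexive (cong (_∷ map ∣_∣ σ) (ℤ.∣-i∣≡∣i∣ x))
abs-actGen (suc i) σ       = abs-swapAt (suc i) σ

χ-actGen : ∀ {n} i σ → i < n → AbsPerm n σ → χ (actGen i σ) ≡ - χ σ
χ-actGen zero σ i<n p with σ | AbsPerm-length p | AbsPerm-nonzero p
χ-actGen {suc n} zero σ i<n p | x ∷ σ′ | _ | x≢0 ∷ _ = χ-neg-head x σ′ x≢0
χ-actGen (suc j) σ j<n p
  with split-adjacent j σ (subst (suc j <_) (sym (AbsPerm-length p)) j<n)
... | xs , ys , a , b , refl , refl =
  trans (cong χ (swapAt-adjacent xs a b ys)) (χ-swap xs a b ys ∣a∣≢∣b∣)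
  where
  ∣a∣≢∣b∣ : ∣ a ∣ ≢ ∣ b ∣
  ∣a∣≢∣b∣ = adjacent-distinct (map ∣_∣ xs) (map ∣_∣ ys)
    (subst Unique (List.map-++ ∣_∣ xs (a ∷ b ∷ ys)) (AbsPerm-unique p))

-- Words in the generators and the sign

run : List ℤ → List ℕ → List ℤ
run σ []      = σ
run σ (i ∷ w) = run (actGen i σ) w

run-++ : ∀ σ u v → run σ (u ++ v) ≡ run (run σ u) v
run-++ σ []      v = refl
run-++ σ (i ∷ u) v = run-++ (actGen i σ) u v

χ-run : ∀ {n} σ w → All (_< n) w → AbsPerm n σ → χ (run σ w) ≡ negOnePow (length w) * χ σ
χ-run σ []      []         p = sym (ℤ.*-identityˡ (χ σ))
χ-run σ (i ∷ w) (i<n ∷ w<n) p = begin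
  χ (run (actGen i σ) w)                     ≡⟨ χ-run (actGen i σ) w w<n (↭-trans (abs-actGen i σ) p) ⟩
  negOnePow (length w) * χ (actGen i σ)      ≡⟨ cong (negOnePow (length w) *_) (χ-actGen i σ i<n p) ⟩
  negOnePow (length w) * - χ σ               ≡⟨ ℤ.neg-distribʳ-* (negOnePow (length w)) (χ σ) ⟨
  - (negOnePow (length w) * χ σ)             ≡⟨ ℤ.neg-distribˡ-* (negOnePow (length w)) (χ σ) ⟩
  negOnePow (suc (length w)) * χ σ           ∎
  where open ≡-Reasoning

χ-idPerm : ∀ n → χ (idPerm n) ≡ 1ℤ
χ-idPerm n = cong negOnePow (cong₂ ℕ._+_
  (trans (cong inversions (trans (abs-idPerm n) (List.map-upTo suc n))) (increasing-inversions suc n (λ _ _ → s≤s)))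
  (no-negatives (upTo n)))
  where
  increasing-countBelow : ∀ x (f : ℕ → ℕ) n → (∀ i → x ≤ f i) → countBelow x (applyUpTo f n) ≡ 0
  increasing-countBelow x f zero    x≤f = refl
  increasing-countBelow x f (suc n) x≤f = cong₂ ℕ._+_ (cong indicator (<ᵇ-false (x≤f 0)))
    (increasing-countBelow x (f ∘ suc) n (x≤f ∘ suc))
  increasing-inversions : ∀ (f : ℕ → ℕ) n → (∀ i j → i < j → f i < f j) → inversions (applyUpTo f n) ≡ 0
  increasing-inversions f zero    f< = refl
  increasing-inversions f (suc n) f< = cong₂ ℕ._+_
    (increasing-countBelow (f 0) (f ∘ suc) n (λ i → ℕ.<⇒≤ (f< 0 (suc i) (s≤s z≤n))))
    (increasing-inversions (f ∘ suc) n (λ i j → f< (suc i) (suc j) ∘ s≤s))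
  no-negatives : ∀ is → neg (map (λ i → + suc i) is) ≡ 0
  no-negatives []       = refl
  no-negatives (i ∷ is) = no-negatives is

-- evalWord folds with a where-bound function, which cannot be named here:
-- the left-hand side of fold≡run is that function, found by unification
-- from its use in evalWord≡run.
mutual
  private
    fold≡run : ∀ n (w v : List ℕ) τ → _ ≡ run τ v
    fold≡run n w []      τ = refl
    fold≡run n w (j ∷ v) τ = fold≡run n w v (actGen j τ)

  evalWord≡run : ∀ n w → evalWord n w ≡ run (idPerm n) w
  evalWord≡run n []      = refl
  evalWord≡run n (i ∷ w) with i ∷ w | actGen i (idPerm n)
  ... | w′ | σ = fold≡run n w′ w σ

∈-words⁻ : ∀ {n} k {w} → w ∈ words n k → length w ≡ k × All (_< n) w
∈-words⁻ zero    (here refl) = refl , []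
∈-words⁻ {n} (suc k) w∈ with ∈-concatMap-witness (λ i → map (i ∷_) (words n k)) (upTo n) w∈
... | i , i∈ , w∈′ with ∈-map⁻ (i ∷_) w∈′
... | v , v∈ , refl with ∈-words⁻ k v∈
... | |v|≡k , v<n = cong suc |v|≡k , ∈-upTo⁻ i∈ ∷ v<n

∈-words⁺ : ∀ {n} w → All (_< n) w → w ∈ words n (length w)
∈-words⁺     []      []          = here refl
∈-words⁺ {n} (i ∷ w) (i<n ∷ w<n) =
  ∈-concatMap-intro (λ i → map (i ∷_) (words n (length w))) (∈-upTo⁺ i<n) (∈-map⁺ (i ∷_) (∈-words⁺ w w<n))

reachable⁻ : ∀ n k σ → T (reachable n k σ) → ∃ λ w → length w ≡ k × All (_< n) w × run (idPerm n) w ≡ σ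
reachable⁻ n k σ r with find (Any.map⁻ (Any.any⁻ _ (map (evalWord n) (words n k)) r))
... | w , w∈ , eval≡ with ∈-words⁻ k w∈
... | |w|≡k , w<n = w , |w|≡k , w<n , trans (sym (evalWord≡run n w)) (toWitness eval≡)

reachable⁺ : ∀ n w σ → All (_< n) w → run (idPerm n) w ≡ σ → T (reachable n (length w) σ)
reachable⁺ n w σ w<n run≡ = Any.any⁺ _ (Any.map⁺ (lose (∈-words⁺ w w<n)
  (fromWitness (trans (evalWord≡run n w) run≡))))

χ-reachable : ∀ n k σ → T (reachable n k σ) → χ σ ≡ negOnePow k
χ-reachable n k σ r with reachable⁻ n k σ r
... | w , refl , w<n , refl = begin
  χ (run (idPerm n) w)                          ≡⟨ χ-run (idPerm n) w w<n ↭-refl ⟩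
  negOnePow (length w) * χ (idPerm n)           ≡⟨ cong (negOnePow (length w) *_) (χ-idPerm n) ⟩
  negOnePow (length w) * 1ℤ                     ≡⟨ ℤ.*-identityʳ _ ⟩
  negOnePow (length w)                          ∎
  where open ≡-Reasoning

length-swapAt : ∀ i (σ : List ℤ) → length (swapAt i σ) ≡ length σ
length-swapAt zero          σ           = refl
length-swapAt (suc zero)    []          = refl
length-swapAt (suc zero)    (x ∷ [])    = refl
length-swapAt (suc zero)    (x ∷ y ∷ σ) = refl
length-swapAt (suc (suc i)) []          = refl
length-swapAt (suc (suc i)) (x ∷ σ)     = cong suc (length-swapAt (suc i) σ)

length-actGen : ∀ i σ → length (actGen i σ) ≡ length σ
length-actGen zero    []      = refl
length-actGen zero    (x ∷ σ) = refl
length-actGen (suc i) σ       = length-swapAt (suc i) σ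

swapAt-++ : ∀ i (σ τ : List ℤ) → suc i < length σ → swapAt (suc i) (σ ++ τ) ≡ swapAt (suc i) σ ++ τ
swapAt-++ zero    (x ∷ y ∷ σ) τ _        = refl
swapAt-++ zero    (x ∷ [])    τ (s≤s ())
swapAt-++ (suc i) (x ∷ σ)     τ (s≤s lt) = cong (x ∷_) (swapAt-++ i σ τ lt)

actGen-++ : ∀ i (σ τ : List ℤ) → i < length σ → actGen i (σ ++ τ) ≡ actGen i σ ++ τ
actGen-++ zero    (x ∷ σ) τ _  = refl
actGen-++ (suc i) σ       τ lt = swapAt-++ i σ τ lt

run-++ˡ : ∀ (σ τ : List ℤ) w → All (_< length σ) w → run (σ ++ τ) w ≡ run σ w ++ τ
run-++ˡ σ τ []      []         = refl
run-++ˡ σ τ (i ∷ w) (i< ∷ w<) = trans (cong (λ ρ → run ρ w) (actGen-++ i σ τ i<))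
  (run-++ˡ (actGen i σ) τ w (subst (λ l → All (_< l) w) (sym (length-actGen i σ)) w<))

length-∷ʳ : ∀ {A : Set} (xs : List A) x → length (xs ∷ʳ x) ≡ suc (length xs)
length-∷ʳ xs x = trans (List.length-++ xs) (ℕ.+-comm (length xs) 1)

-- moveLeft j k carries the entry at position j + k + 1 to position j + 1,
-- moveRight j k carries the entry at position j + 1 to position j + k + 1.
moveLeft : ℕ → ℕ → List ℕ
moveLeft j zero    = []
moveLeft j (suc k) = moveLeft (suc j) k ++ [ suc j ]

moveRight : ℕ → ℕ → List ℕ
moveRight j zero    = []
moveRight j (suc k) = suc j ∷ moveRight (suc j) k

length-moveLeft : ∀ j k → length (moveLeft j k) ≡ k
length-moveLeft j zero    = refl
length-moveLeft j (suc k) = trans (List.length-++ (moveLeft (suc j) k))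
  (trans (ℕ.+-comm (length (moveLeft (suc j) k)) 1) (cong suc (length-moveLeft (suc j) k)))

length-moveRight : ∀ j k → length (moveRight j k) ≡ k
length-moveRight j zero    = refl
length-moveRight j (suc k) = cong suc (length-moveRight (suc j) k)

moveLeft-letters : ∀ j k → All (_≤ j ℕ.+ k) (moveLeft j k)
moveLeft-letters j zero    = []
moveLeft-letters j (suc k) = subst (λ l → All (_≤ l) (moveLeft j (suc k))) (sym (ℕ.+-suc j k))
  (All.++⁺ (moveLeft-letters (suc j) k) (s≤s (ℕ.m≤m+n j k) ∷ []))

moveRight-letters : ∀ j k → All (_≤ j ℕ.+ k) (moveRight j k)
moveRight-letters j zero    = []
moveRight-letters j (suc k) = subst (λ l → All (_≤ l) (moveRight j (suc k))) (sym (ℕ.+-suc j k))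
  (s≤s (ℕ.m≤m+n j k) ∷ moveRight-letters (suc j) k)

run-moveLeft : ∀ (a b : List ℤ) x → run ((a ++ b) ∷ʳ x) (moveLeft (length a) (length b)) ≡ a ++ x ∷ b
run-moveLeft a []       x = cong (_∷ʳ x) (List.++-identityʳ a)
run-moveLeft a (y ∷ b)  x = begin
  run ((a ++ y ∷ b) ∷ʳ x) (moveLeft (suc (length a)) (length b) ++ [ suc (length a) ])
    ≡⟨ run-++ ((a ++ y ∷ b) ∷ʳ x) (moveLeft (suc (length a)) (length b)) [ suc (length a) ] ⟩
  actGen (suc (length a)) (run ((a ++ y ∷ b) ∷ʳ x) (moveLeft (suc (length a)) (length b)))
    ≡⟨ cong (actGen (suc (length a))) moved ⟩
  swapAt (suc (length a)) (a ++ y ∷ x ∷ b)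
    ≡⟨ swapAt-adjacent a y x b ⟩
  a ++ x ∷ y ∷ b
    ∎
  where
  open ≡-Reasoning
  moved : run ((a ++ y ∷ b) ∷ʳ x) (moveLeft (suc (length a)) (length b)) ≡ a ++ y ∷ x ∷ b
  moved = trans
    (cong₂ (λ ρ l → run (ρ ∷ʳ x) (moveLeft l (length b))) (sym (List.∷ʳ-++ a y b)) (sym (length-∷ʳ a y)))
    (trans (run-moveLeft (a ∷ʳ y) b x) (List.∷ʳ-++ a y (x ∷ b)))

run-moveRight : ∀ (p : List ℤ) z (a b : List ℤ) → run (p ++ z ∷ a ++ b) (moveRight (length p) (length a)) ≡ p ++ a ++ z ∷ b
run-moveRight p z []      b = refl
run-moveRight p z (y ∷ a) b = begin
  run (actGen (suc (length p)) (p ++ z ∷ y ∷ a ++ b)) (moveRight (suc (length p)) (length a))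
    ≡⟨ cong (λ ρ → run ρ (moveRight (suc (length p)) (length a))) (swapAt-adjacent p z y (a ++ b)) ⟩
  run (p ++ y ∷ z ∷ a ++ b) (moveRight (suc (length p)) (length a))
    ≡⟨ cong₂ (λ ρ l → run ρ (moveRight l (length a))) (sym (List.∷ʳ-++ p y (z ∷ a ++ b))) (sym (length-∷ʳ p y)) ⟩
  run ((p ∷ʳ y) ++ z ∷ a ++ b) (moveRight (length (p ∷ʳ y)) (length a))
    ≡⟨ run-moveRight (p ∷ʳ y) z a b ⟩
  (p ∷ʳ y) ++ a ++ z ∷ b
    ≡⟨ List.∷ʳ-++ p y (a ++ z ∷ b) ⟩
  p ++ y ∷ a ++ z ∷ b
    ∎
  where open ≡-Reasoning

insert-word : ∀ {m} (a b : List ℤ) x y → length a ℕ.+ length b ≡ m → y ≡ x ⊎ y ≡ - x →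
  ∃ λ w → length w ≤ m ℕ.+ suc m × All (_< suc m) w × run ((a ++ b) ∷ʳ x) w ≡ a ++ y ∷ b
insert-word {m} a b x y refl (inj₁ refl) =
  moveLeft (length a) (length b) ,
  subst (_≤ m ℕ.+ suc m) (sym (length-moveLeft (length a) (length b)))
    (ℕ.≤-trans (ℕ.m≤n+m (length b) (length a)) (ℕ.m≤m+n m (suc m))) ,
  All.map s≤s (moveLeft-letters (length a) (length b)) ,
  run-moveLeft a b x
insert-word {m} a b x y refl (inj₂ refl) =
  w , length-w , All.++⁺ (All.map s≤s left-letters) (s≤s z≤n ∷ All.map (λ le → s≤s (ℕ.≤-trans le a≤m)) right-letters) , run-w
  where
  w : List ℕ
  w = moveLeft 0 (length (a ++ b)) ++ 0 ∷ moveRight 0 (length a)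
  a≤m : length a ≤ m
  a≤m = ℕ.m≤m+n (length a) (length b)
  |a++b|≡m : length (a ++ b) ≡ m
  |a++b|≡m = List.length-++ a
  left-letters : All (_≤ m) (moveLeft 0 (length (a ++ b)))
  left-letters = subst (λ l → All (_≤ l) (moveLeft 0 (length (a ++ b)))) |a++b|≡m
    (moveLeft-letters 0 (length (a ++ b)))
  right-letters : All (_≤ length a) (moveRight 0 (length a))
  right-letters = moveRight-letters 0 (length a)
  length-w : length w ≤ m ℕ.+ suc m
  length-w = subst (_≤ m ℕ.+ suc m)
    (sym (trans (List.length-++ (moveLeft 0 (length (a ++ b))))
      (cong₂ (λ l l′ → l ℕ.+ suc l′) (trans (length-moveLeft 0 (length (a ++ b))) |a++b|≡m)
                                    (length-moveRight 0 (length a)))))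
    (ℕ.+-monoʳ-≤ m (s≤s a≤m))
  run-w : run ((a ++ b) ∷ʳ x) w ≡ a ++ - x ∷ b
  run-w = begin
    run ((a ++ b) ∷ʳ x) w
      ≡⟨ run-++ ((a ++ b) ∷ʳ x) (moveLeft 0 (length (a ++ b))) (0 ∷ moveRight 0 (length a)) ⟩
    run (run ((a ++ b) ∷ʳ x) (moveLeft 0 (length (a ++ b)))) (0 ∷ moveRight 0 (length a))
      ≡⟨ cong (λ ρ → run ρ (0 ∷ moveRight 0 (length a))) (run-moveLeft [] (a ++ b) x) ⟩
    run (- x ∷ a ++ b) (moveRight 0 (length a))
      ≡⟨ run-moveRight [] (- x) a b ⟩
    a ++ - x ∷ b
      ∎
    where open ≡-Reasoning

idPerm-∷ʳ : ∀ m → idPerm (suc m) ≡ idPerm m ∷ʳ + suc m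
idPerm-∷ʳ m = trans (cong (map (λ i → + suc i)) (sym (List.upTo-∷ʳ m))) (List.map-++ (λ i → + suc i) (upTo m) [ m ])

B-suc-↭ : ∀ m → B (suc m) ↭ signedPerms (+ suc m ∷ idPerm m)
B-suc-↭ m = ↭-trans (↭-reflexive (cong signedPerms (idPerm-∷ʳ m)))
  (signedPerms-↭ (↭-sym (↭.∷↭∷ʳ (+ suc m) (idPerm m))))

∈-B⇒short-word : ∀ n σ → σ ∈ B n → ∃ λ w → length w ≤ n ℕ.* n × All (_< n) w × run (idPerm n) w ≡ σ
∈-B⇒short-word zero    σ (here refl) = [] , z≤n , [] , refl
∈-B⇒short-word (suc m) σ σ∈ with ∈-signedPerms-∷⁻ (+ suc m) (idPerm m) (↭.∈-resp-↭ (B-suc-↭ m) σ∈)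
... | a , b , y , refl , y≡±x , ab∈ with ∈-B⇒short-word m (a ++ b) ab∈ | insert-word a b (+ suc m) y |a|+|b|≡m y≡±x
  where
  |a|+|b|≡m : length a ℕ.+ length b ≡ m
  |a|+|b|≡m = trans (sym (List.length-++ a)) (AbsPerm-length (∈-signedPerms⇒abs-↭ (idPerm m) ab∈))
... | w₁ , |w₁|≤ , w₁< , run-w₁ | w₂ , |w₂|≤ , w₂< , run-w₂ =
  w₁ ++ w₂ , length-bound , All.++⁺ (All.map ℕ.m<n⇒m<1+n w₁<) w₂< , run-eq
  where
  square : ∀ m → m ℕ.* m ℕ.+ (m ℕ.+ suc m) ≡ suc m ℕ.* suc m
  square = ℕ-Solver.solve-∀
  length-bound : length (w₁ ++ w₂) ≤ suc m ℕ.* suc m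
  length-bound = subst₂ _≤_ (sym (List.length-++ w₁)) (square m) (ℕ.+-mono-≤ |w₁|≤ |w₂|≤)
  run-eq : run (idPerm (suc m)) (w₁ ++ w₂) ≡ a ++ y ∷ b
  run-eq = begin
    run (idPerm (suc m)) (w₁ ++ w₂)
      ≡⟨ run-++ (idPerm (suc m)) w₁ w₂ ⟩
    run (run (idPerm (suc m)) w₁) w₂
      ≡⟨ cong (λ ρ → run (run ρ w₁) w₂) (idPerm-∷ʳ m) ⟩
    run (run (idPerm m ∷ʳ + suc m) w₁) w₂
      ≡⟨ cong (λ ρ → run ρ w₂) (run-++ˡ (idPerm m) [ + suc m ] w₁ w₁<length) ⟩
    run (run (idPerm m) w₁ ∷ʳ + suc m) w₂
      ≡⟨ cong (λ ρ → run (ρ ∷ʳ + suc m) w₂) run-w₁ ⟩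
    run ((a ++ b) ∷ʳ + suc m) w₂
      ≡⟨ run-w₂ ⟩
    a ++ y ∷ b
      ∎
    where
    open ≡-Reasoning
    w₁<length : All (_< length (idPerm m)) w₁
    w₁<length = subst (λ l → All (_< l) w₁) (sym (AbsPerm-length {m} {idPerm m} ↭-refl)) w₁<

searchLen-reachable : ∀ n σ {j} k fuel → T (reachable n j σ) → k ≤ j → j ≤ k ℕ.+ fuel →
  T (reachable n (searchLen n σ k fuel) σ)
searchLen-reachable n σ {j} k zero       r k≤j j≤k+0 =
  subst (λ i → T (reachable n i σ)) (ℕ.≤-antisym (subst (j ≤_) (ℕ.+-identityʳ k) j≤k+0) k≤j) r
searchLen-reachable n σ {j} k (suc fuel) r k≤j j≤k+1+fuel with reachable n k σ in eq
... | true  = subst T (sym eq) tt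
... | false =
  searchLen-reachable n σ (suc k) fuel r (ℕ.≤∧≢⇒< k≤j k≢j) (subst (j ≤_) (ℕ.+-suc k fuel) j≤k+1+fuel)
  where
  k≢j : k ≢ j
  k≢j refl = subst T eq r

sign≡χ : ∀ n σ → σ ∈ B n → sign n σ ≡ χ σ
sign≡χ n σ σ∈ with ∈-B⇒short-word n σ σ∈
... | w , |w|≤n² , w<n , run≡σ = sym (χ-reachable n (coxLen n σ) σ
  (searchLen-reachable n σ 0 (n ℕ.* n) (reachable⁺ n w σ w<n run≡σ) z≤n |w|≤n²))

-- Relabelling B (suc m)

data Letter (m : ℕ) : ℤ → Set where
  +letter : ∀ {a} → a < m → Letter m (+ suc a)
  -letter : ∀ {a} → a < m → Letter m -[1+ a ]

data HighLetter (m : ℕ) : ℤ → Set where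
  +high : ∀ {a} → a < m → HighLetter m (+ suc (suc a))
  -high : ∀ {a} → a < m → HighLetter m -[1+ suc a ]

data HighOrOne (m : ℕ) : ℤ → Set where
  high : ∀ {x} → HighLetter m x → HighOrOne m x
  one  : HighOrOne m (+ 1)

relabel : ℕ → ℤ → ℤ
relabel m (+ zero)          = + 0
relabel m (+ suc zero)      = -[1+ m ]
relabel m (+ suc (suc a))   = + suc a
relabel m -[1+ zero ]       = + suc m
relabel m -[1+ suc a ]      = -[1+ a ]

relabel-odd : ∀ m → Odd (relabel m)
relabel-odd m (+ zero)        = refl
relabel-odd m (+ suc zero)    = refl
relabel-odd m (+ suc (suc a)) = refl
relabel-odd m -[1+ zero ]     = refl
relabel-odd m -[1+ suc a ]    = refl

relabel-high : ∀ {m x} → HighLetter m x → Letter m (relabel m x)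
relabel-high (+high a<m) = +letter a<m
relabel-high (-high a<m) = -letter a<m

relabel-≺ : ∀ {m x y} → HighOrOne m x → HighOrOne m y → (relabel m y ≺ relabel m x) ≡ (y ≺ x)
relabel-≺ (high (+high _))   (high (+high _))   = refl
relabel-≺ (high (+high _))   (high (-high _))   = refl
relabel-≺ (high (-high _))   (high (+high _))   = refl
relabel-≺ (high (-high _))   (high (-high _))   = refl
relabel-≺ (high (+high _))   one                = refl
relabel-≺ (high (-high a<m)) one                = <ᵇ-false (ℕ.<⇒≤ a<m)
relabel-≺ one                (high (+high _))   = refl
relabel-≺ one                (high (-high b<m)) = <ᵇ-true b<m
relabel-≺ {m} one            one                = <ᵇ-false (ℕ.≤-refl {m})

relabel-≺-top : ∀ {m y} → HighOrOne m y → (relabel m y ≺ + suc m) ≡ true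
relabel-≺-top (high (+high b<m)) = <ᵇ-true b<m
relabel-≺-top (high (-high _))   = refl
relabel-≺-top one                = refl

top-≺-relabel : ∀ {m x} → HighOrOne m x → (+ suc m ≺ relabel m x) ≡ false
top-≺-relabel (high (+high a<m)) = <ᵇ-false (ℕ.<⇒≤ a<m)
top-≺-relabel (high (-high _))   = refl
top-≺-relabel one                = refl

≺-minus-one : ∀ {m y} → HighOrOne m y → (y ≺ -[1+ 0 ]) ≡ false
≺-minus-one (high (+high _)) = refl
≺-minus-one (high (-high _)) = refl
≺-minus-one one              = refl

minus-one-≺ : ∀ {m x} → HighOrOne m x → (-[1+ 0 ] ≺ x) ≡ true
minus-one-≺ (high (+high _)) = refl
minus-one-≺ (high (-high _)) = refl
minus-one-≺ one              = refl

majFrom-relabel : ∀ {m} p σ → All (HighOrOne m) σ → majFrom p (map (relabel m) σ) ≡ majFrom p σ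
majFrom-relabel p []          _                  = refl
majFrom-relabel p (x ∷ [])    _                  = refl
majFrom-relabel p (x ∷ y ∷ σ) (hx ∷ hy ∷ hσ) =
  cong₂ ℕ._+_ (cong (λ b → if b then p else 0) (relabel-≺ hx hy)) (majFrom-relabel (suc p) (y ∷ σ) (hy ∷ hσ))

majFrom-relabel-minus-one-head : ∀ {m} p y σ → All (HighOrOne m) (y ∷ σ) →
  majFrom p (map (relabel m) (-[1+ 0 ] ∷ y ∷ σ)) ≡ p ℕ.+ majFrom p (-[1+ 0 ] ∷ y ∷ σ)
majFrom-relabel-minus-one-head p y σ (hy ∷ hσ) = cong₂ ℕ._+_
  (cong (λ b → if b then p else 0) (relabel-≺-top hy))
  (trans (majFrom-relabel (suc p) (y ∷ σ) (hy ∷ hσ))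
    (cong (λ b → (if b then p else 0) ℕ.+ majFrom (suc p) (y ∷ σ)) (sym (≺-minus-one hy))))

majFrom-relabel-minus-one : ∀ {m} p x α y β → All (HighOrOne m) (x ∷ α) → All (HighOrOne m) (y ∷ β) →
  majFrom p (map (relabel m) (x ∷ α ++ -[1+ 0 ] ∷ y ∷ β)) ≡ suc (majFrom p (x ∷ α ++ -[1+ 0 ] ∷ y ∷ β))
majFrom-relabel-minus-one p x []      y β (hx ∷ []) hyβ = trans
  (cong₂ ℕ._+_ (cong (λ b → if b then p else 0) (top-≺-relabel hx)) (majFrom-relabel-minus-one-head (suc p) y β hyβ))
  (cong (λ b → suc ((if b then p else 0) ℕ.+ majFrom (suc p) (-[1+ 0 ] ∷ y ∷ β))) (sym (minus-one-≺ hx)))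
majFrom-relabel-minus-one p x (a ∷ α) y β (hx ∷ ha ∷ hα) hyβ =
  trans (cong₂ ℕ._+_ (cong (λ b → if b then p else 0) (relabel-≺ hx ha))
                     (majFrom-relabel-minus-one (suc p) a α y β (ha ∷ hα) hyβ))
    (ℕ.+-suc _ _)

lastDescent : ℕ → List ℤ → ℤ → ℕ
lastDescent p []          z = 0
lastDescent p (x ∷ [])    z = if z ≺ x then p else 0
lastDescent p (x ∷ y ∷ σ) z = lastDescent (suc p) (y ∷ σ) z

majFrom-∷ʳ : ∀ p σ z → majFrom p (σ ∷ʳ z) ≡ majFrom p σ ℕ.+ lastDescent p σ z
majFrom-∷ʳ p []          z = refl
majFrom-∷ʳ p (x ∷ [])    z = ℕ.+-identityʳ _
majFrom-∷ʳ p (x ∷ y ∷ σ) z = trans (cong ((if y ≺ x then p else 0) ℕ.+_) (majFrom-∷ʳ (suc p) (y ∷ σ) z))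
  (sym (ℕ.+-assoc (if y ≺ x then p else 0) (majFrom (suc p) (y ∷ σ)) (lastDescent (suc p) (y ∷ σ) z)))

lastDescent-minus-one : ∀ {m} p x σ → All (HighLetter m) (x ∷ σ) →
  lastDescent (suc p) (x ∷ σ) -[1+ 0 ] ≡ p ℕ.+ length (x ∷ σ)
lastDescent-minus-one p x []      (hx ∷ []) =
  trans (cong (λ b → if b then suc p else 0) (minus-one-≺ (high hx))) (ℕ.+-comm 1 p)
lastDescent-minus-one p x (y ∷ σ) (hx ∷ hσ) = trans (lastDescent-minus-one (suc p) y σ hσ) (sym (ℕ.+-suc p _))

lastDescent-top : ∀ {m} p ρ → All (Letter m) ρ → lastDescent p ρ (+ suc m) ≡ 0
lastDescent-top p []          _                   = refl
lastDescent-top p (x ∷ [])    (+letter a<m ∷ [])  = cong (λ b → if b then p else 0) (<ᵇ-false (ℕ.<⇒≤ a<m))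
lastDescent-top p (x ∷ [])    (-letter _ ∷ [])    = refl
lastDescent-top p (x ∷ y ∷ ρ) (_ ∷ lρ)            = lastDescent-top (suc p) (y ∷ ρ) lρ

neg-relabel-high : ∀ {m} τ → All (HighLetter m) τ → neg (map (relabel m) τ) ≡ neg τ
neg-relabel-high []      []              = refl
neg-relabel-high (_ ∷ τ) (+high _ ∷ hτ) = neg-relabel-high τ hτ
neg-relabel-high (_ ∷ τ) (-high _ ∷ hτ) = cong suc (neg-relabel-high τ hτ)

countBelow-relabel-high : ∀ {m x} τ → HighLetter m x → All (HighLetter m) τ →
  countBelow (∣ relabel m x ∣) (map ∣_∣ (map (relabel m) τ)) ≡ countBelow ∣ x ∣ (map ∣_∣ τ)
countBelow-relabel-high []      hx          []        = refl
countBelow-relabel-high (y ∷ τ) hx@(+high _) (+high _ ∷ hτ) = cong (_ ℕ.+_) (countBelow-relabel-high τ hx hτ)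
countBelow-relabel-high (y ∷ τ) hx@(+high _) (-high _ ∷ hτ) = cong (_ ℕ.+_) (countBelow-relabel-high τ hx hτ)
countBelow-relabel-high (y ∷ τ) hx@(-high _) (+high _ ∷ hτ) = cong (_ ℕ.+_) (countBelow-relabel-high τ hx hτ)
countBelow-relabel-high (y ∷ τ) hx@(-high _) (-high _ ∷ hτ) = cong (_ ℕ.+_) (countBelow-relabel-high τ hx hτ)

inversions-relabel-high : ∀ {m} τ → All (HighLetter m) τ →
  inversions (map ∣_∣ (map (relabel m) τ)) ≡ inversions (map ∣_∣ τ)
inversions-relabel-high []      []        = refl
inversions-relabel-high (x ∷ τ) (hx ∷ hτ) =
  cong₂ ℕ._+_ (countBelow-relabel-high τ hx hτ) (inversions-relabel-high τ hτ)

χ-relabel-high : ∀ {m} τ → All (HighLetter m) τ → χ (map (relabel m) τ) ≡ χ τ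
χ-relabel-high τ hτ = cong negOnePow (cong₂ ℕ._+_ (inversions-relabel-high τ hτ) (neg-relabel-high τ hτ))

fmaj-relabel-high : ∀ {m} τ → All (HighLetter m) τ → fmaj (map (relabel m) τ) ≡ fmaj τ
fmaj-relabel-high τ hτ =
  cong₂ (λ a b → 2 ℕ.* a ℕ.+ b) (majFrom-relabel 1 τ (All.map high hτ)) (neg-relabel-high τ hτ)

countAbove-top : ∀ {m} ρ → All (Letter m) ρ → countAbove (suc m) (map ∣_∣ ρ) ≡ 0
countAbove-top []      []                = refl
countAbove-top (_ ∷ ρ) (+letter a<m ∷ lρ) =
  cong₂ ℕ._+_ (cong indicator (<ᵇ-false (ℕ.<⇒≤ a<m))) (countAbove-top ρ lρ)
countAbove-top (_ ∷ ρ) (-letter a<m ∷ lρ) =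
  cong₂ ℕ._+_ (cong indicator (<ᵇ-false (ℕ.<⇒≤ a<m))) (countAbove-top ρ lρ)

χ-∷ʳ-top : ∀ {m} ρ → All (Letter m) ρ → χ (ρ ∷ʳ + suc m) ≡ χ ρ
χ-∷ʳ-top {m} ρ lρ =
  cong negOnePow (cong₂ ℕ._+_ abs-inversions (trans (neg-++ ρ [ + suc m ]) (ℕ.+-identityʳ (neg ρ))))
  where
  abs-inversions : inversions (map ∣_∣ (ρ ∷ʳ + suc m)) ≡ inversions (map ∣_∣ ρ)
  abs-inversions = trans (cong inversions (List.map-++ ∣_∣ ρ [ + suc m ]))
    (trans (inversions-∷ʳ (map ∣_∣ ρ) (suc m)) (trans (cong (_ ℕ.+_) (countAbove-top ρ lρ)) (ℕ.+-identityʳ _)))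

fmaj-∷ʳ-top : ∀ {m} ρ → All (Letter m) ρ → fmaj (ρ ∷ʳ + suc m) ≡ fmaj ρ
fmaj-∷ʳ-top {m} ρ lρ = cong₂ (λ a b → 2 ℕ.* a ℕ.+ b)
  (trans (majFrom-∷ʳ 1 ρ (+ suc m)) (trans (cong (maj ρ ℕ.+_) (lastDescent-top 1 ρ lρ)) (ℕ.+-identityʳ (maj ρ))))
  (trans (neg-++ ρ [ + suc m ]) (ℕ.+-identityʳ (neg ρ)))

countAbove-one : ∀ {m} τ → All (HighLetter m) τ → countAbove 1 (map ∣_∣ τ) ≡ length τ
countAbove-one []      []             = refl
countAbove-one (_ ∷ τ) (+high _ ∷ hτ) = cong suc (countAbove-one τ hτ)
countAbove-one (_ ∷ τ) (-high _ ∷ hτ) = cong suc (countAbove-one τ hτ)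

χ-∷ʳ-minus-one : ∀ {m} τ → All (HighLetter m) τ → length τ ≡ m →
                 χ (τ ∷ʳ -[1+ 0 ]) ≡ negOnePow (suc m) * χ τ
χ-∷ʳ-minus-one {m} τ hτ |τ|≡m = begin
  negOnePow (inversions (map ∣_∣ (τ ∷ʳ -[1+ 0 ])) ℕ.+ neg (τ ∷ʳ -[1+ 0 ]))
    ≡⟨ cong negOnePow (cong₂ ℕ._+_ abs-inversions (neg-++ τ [ -[1+ 0 ] ])) ⟩
  negOnePow (inversions (map ∣_∣ τ) ℕ.+ m ℕ.+ (neg τ ℕ.+ 1))
    ≡⟨ cong negOnePow (regroup (inversions (map ∣_∣ τ)) m (neg τ)) ⟩
  negOnePow (suc m ℕ.+ (inversions (map ∣_∣ τ) ℕ.+ neg τ))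
    ≡⟨ negOnePow-+ (suc m) _ ⟩
  negOnePow (suc m) * χ τ
    ∎
  where
  open ≡-Reasoning
  abs-inversions : inversions (map ∣_∣ (τ ∷ʳ -[1+ 0 ])) ≡ inversions (map ∣_∣ τ) ℕ.+ m
  abs-inversions = trans (cong inversions (List.map-++ ∣_∣ τ [ -[1+ 0 ] ]))
    (trans (inversions-∷ʳ (map ∣_∣ τ) 1) (cong (_ ℕ.+_) (trans (countAbove-one τ hτ) |τ|≡m)))
  regroup : ∀ i m n → i ℕ.+ m ℕ.+ (n ℕ.+ 1) ≡ suc m ℕ.+ (i ℕ.+ n)
  regroup = ℕ-Solver.solve-∀

fmaj-∷ʳ-minus-one : ∀ {m} τ → All (HighLetter m) τ → length τ ≡ m →
                    fmaj (τ ∷ʳ -[1+ 0 ]) ≡ 2 ℕ.* m ℕ.+ 1 ℕ.+ fmaj τ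
fmaj-∷ʳ-minus-one {m} τ hτ |τ|≡m = begin
  2 ℕ.* maj (τ ∷ʳ -[1+ 0 ]) ℕ.+ neg (τ ∷ʳ -[1+ 0 ])
    ≡⟨ cong₂ (λ a b → 2 ℕ.* a ℕ.+ b) (majFrom-∷ʳ 1 τ -[1+ 0 ]) (neg-++ τ [ -[1+ 0 ] ]) ⟩
  2 ℕ.* (maj τ ℕ.+ lastDescent 1 τ -[1+ 0 ]) ℕ.+ (neg τ ℕ.+ 1)
    ≡⟨ cong (λ d → 2 ℕ.* (maj τ ℕ.+ d) ℕ.+ (neg τ ℕ.+ 1)) (trans (last-descent τ hτ) |τ|≡m) ⟩
  2 ℕ.* (maj τ ℕ.+ m) ℕ.+ (neg τ ℕ.+ 1)
    ≡⟨ regroup (maj τ) m (neg τ) ⟩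
  2 ℕ.* m ℕ.+ 1 ℕ.+ fmaj τ
    ∎
  where
  open ≡-Reasoning
  last-descent : ∀ τ → All (HighLetter m) τ → lastDescent 1 τ -[1+ 0 ] ≡ length τ
  last-descent []      _  = refl
  last-descent (x ∷ τ) hτ = lastDescent-minus-one 0 x τ hτ
  regroup : ∀ a m n → 2 ℕ.* (a ℕ.+ m) ℕ.+ (n ℕ.+ 1) ≡ 2 ℕ.* m ℕ.+ 1 ℕ.+ (2 ℕ.* a ℕ.+ n)
  regroup = ℕ-Solver.solve-∀

IsUnit : ℤ → Set
IsUnit u = u ≡ + 1 ⊎ u ≡ -[1+ 0 ]

neg-insert : ∀ α u β → neg (α ++ u ∷ β) ≡ indicator (isNeg u) ℕ.+ (neg α ℕ.+ neg β)
neg-insert α u β = trans (neg-++ α (u ∷ β)) (exchange (neg α) (indicator (isNeg u)) (neg β))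
  where
  exchange : ∀ x y z → x ℕ.+ (y ℕ.+ z) ≡ y ℕ.+ (x ℕ.+ z)
  exchange = ℕ-Solver.solve-∀

neg-relabel-insert : ∀ {m} α u β → All (HighLetter m) α → All (HighLetter m) β →
  neg (map (relabel m) (α ++ u ∷ β)) ≡ indicator (isNeg (relabel m u)) ℕ.+ (neg α ℕ.+ neg β)
neg-relabel-insert {m} α u β hα hβ = begin
  neg (map (relabel m) (α ++ u ∷ β))
    ≡⟨ cong neg (List.map-++ (relabel m) α (u ∷ β)) ⟩
  neg (map (relabel m) α ++ relabel m u ∷ map (relabel m) β)
    ≡⟨ neg-insert (map (relabel m) α) (relabel m u) (map (relabel m) β) ⟩
  e ℕ.+ (neg (map (relabel m) α) ℕ.+ neg (map (relabel m) β))
    ≡⟨ cong₂ (λ a b → e ℕ.+ (a ℕ.+ b)) (neg-relabel-high α hα) (neg-relabel-high β hβ) ⟩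
  e ℕ.+ (neg α ℕ.+ neg β)
    ∎
  where
  open ≡-Reasoning
  e : ℕ
  e = indicator (isNeg (relabel m u))

countBelow-one : ∀ {m} τ → All (HighLetter m) τ → countBelow 1 (map ∣_∣ τ) ≡ 0
countBelow-one []      []             = refl
countBelow-one (_ ∷ τ) (+high _ ∷ hτ) = countBelow-one τ hτ
countBelow-one (_ ∷ τ) (-high _ ∷ hτ) = countBelow-one τ hτ

countBelow-top : ∀ {m} ρ → All (Letter m) ρ → countBelow (suc m) (map ∣_∣ ρ) ≡ length ρ
countBelow-top []      []                 = refl
countBelow-top (_ ∷ ρ) (+letter a<m ∷ lρ) = cong₂ ℕ._+_ (cong indicator (<ᵇ-true (s≤s a<m))) (countBelow-top ρ lρ)
countBelow-top (_ ∷ ρ) (-letter a<m ∷ lρ) = cong₂ ℕ._+_ (cong indicator (<ᵇ-true (s≤s a<m))) (countBelow-top ρ lρ)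

inversions-insert-one : ∀ {m} α u β → All (HighLetter m) α → All (HighLetter m) β → IsUnit u →
  inversions (map ∣_∣ (α ++ u ∷ β)) ≡ inversions (map ∣_∣ (α ++ β)) ℕ.+ length α
inversions-insert-one α u β hα hβ u≡±1 = begin
  inversions (map ∣_∣ (α ++ u ∷ β))
    ≡⟨ cong inversions (List.map-++ ∣_∣ α (u ∷ β)) ⟩
  inversions (map ∣_∣ α ++ ∣ u ∣ ∷ map ∣_∣ β)
    ≡⟨ cong (λ a → inversions (map ∣_∣ α ++ a ∷ map ∣_∣ β)) (∣unit∣ u≡±1) ⟩
  inversions (map ∣_∣ α ++ 1 ∷ map ∣_∣ β)
    ≡⟨ inversions-insert (map ∣_∣ α) 1 (map ∣_∣ β) ⟩
  inversions (map ∣_∣ α ++ map ∣_∣ β) ℕ.+ (countAbove 1 (map ∣_∣ α) ℕ.+ countBelow 1 (map ∣_∣ β))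
    ≡⟨ cong₂ (λ xs c → inversions xs ℕ.+ c) (sym (List.map-++ ∣_∣ α β))
         (trans (cong₂ ℕ._+_ (countAbove-one α hα) (countBelow-one β hβ)) (ℕ.+-identityʳ _)) ⟩
  inversions (map ∣_∣ (α ++ β)) ℕ.+ length α
    ∎
  where
  open ≡-Reasoning
  ∣unit∣ : ∀ {u} → IsUnit u → ∣ u ∣ ≡ 1
  ∣unit∣ (inj₁ refl) = refl
  ∣unit∣ (inj₂ refl) = refl

relabel-highs : ∀ {m τ} → All (HighLetter m) τ → All (Letter m) (map (relabel m) τ)
relabel-highs hτ = All.map⁺ (All.map relabel-high hτ)

unit-signs : ∀ {m u} → IsUnit u → indicator (isNeg (relabel m u)) ℕ.+ indicator (isNeg u) ≡ 1
unit-signs (inj₁ refl) = refl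
unit-signs (inj₂ refl) = refl

∣relabel-unit∣ : ∀ {m u} → IsUnit u → ∣ relabel m u ∣ ≡ suc m
∣relabel-unit∣ (inj₁ refl) = refl
∣relabel-unit∣ (inj₂ refl) = refl

inversions-relabel-insert-one : ∀ {m} α u β → All (HighLetter m) α → All (HighLetter m) β → IsUnit u →
  inversions (map ∣_∣ (map (relabel m) (α ++ u ∷ β))) ≡ inversions (map ∣_∣ (α ++ β)) ℕ.+ length β
inversions-relabel-insert-one {m} α u β hα hβ u≡±1 = begin
  inversions (map ∣_∣ (map g (α ++ u ∷ β)))
    ≡⟨ cong (inversions ∘ map ∣_∣) (List.map-++ g α (u ∷ β)) ⟩
  inversions (map ∣_∣ (map g α ++ g u ∷ map g β))
    ≡⟨ cong inversions (List.map-++ ∣_∣ (map g α) (g u ∷ map g β)) ⟩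
  inversions (map ∣_∣ (map g α) ++ ∣ g u ∣ ∷ map ∣_∣ (map g β))
    ≡⟨ cong (λ a → inversions (map ∣_∣ (map g α) ++ a ∷ map ∣_∣ (map g β))) (∣relabel-unit∣ u≡±1) ⟩
  inversions (map ∣_∣ (map g α) ++ suc m ∷ map ∣_∣ (map g β))
    ≡⟨ inversions-insert (map ∣_∣ (map g α)) (suc m) (map ∣_∣ (map g β)) ⟩
  inversions (map ∣_∣ (map g α) ++ map ∣_∣ (map g β)) ℕ.+ (countAbove (suc m) (map ∣_∣ (map g α)) ℕ.+ countBelow (suc m) (map ∣_∣ (map g β)))
    ≡⟨ cong₂ (λ i c → i ℕ.+ (c ℕ.+ countBelow (suc m) (map ∣_∣ (map g β)))) remove-unit (countAbove-top (map g α) (relabel-highs hα)) ⟩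
  inversions (map ∣_∣ (α ++ β)) ℕ.+ countBelow (suc m) (map ∣_∣ (map g β))
    ≡⟨ cong (inversions (map ∣_∣ (α ++ β)) ℕ.+_) (trans (countBelow-top (map g β) (relabel-highs hβ)) (List.length-map g β)) ⟩
  inversions (map ∣_∣ (α ++ β)) ℕ.+ length β
    ∎
  where
  open ≡-Reasoning
  g : ℤ → ℤ
  g = relabel m
  remove-unit : inversions (map ∣_∣ (map g α) ++ map ∣_∣ (map g β)) ≡ inversions (map ∣_∣ (α ++ β))
  remove-unit = begin
    inversions (map ∣_∣ (map g α) ++ map ∣_∣ (map g β))
      ≡⟨ cong inversions (List.map-++ ∣_∣ (map g α) (map g β)) ⟨
    inversions (map ∣_∣ (map g α ++ map g β))
      ≡⟨ cong (inversions ∘ map ∣_∣) (List.map-++ g α β) ⟨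
    inversions (map ∣_∣ (map g (α ++ β)))
      ≡⟨ inversions-relabel-high (α ++ β) (All.++⁺ hα hβ) ⟩
    inversions (map ∣_∣ (α ++ β))
      ∎

χ-relabel-insert-one : ∀ {m} α u β → All (HighLetter m) α → All (HighLetter m) β → length α ℕ.+ length β ≡ m →
  IsUnit u → χ (map (relabel m) (α ++ u ∷ β)) ≡ negOnePow (suc m) * χ (α ++ u ∷ β)
χ-relabel-insert-one {m} α u β hα hβ |α|+|β|≡m u≡±1 =
  negOnePow-parity (exponent (map g (α ++ u ∷ β))) (exponent (α ++ u ∷ β)) (suc m) (I ℕ.+ N) (begin
  exponent (map g (α ++ u ∷ β)) ℕ.+ exponent (α ++ u ∷ β)
    ≡⟨ cong₂ ℕ._+_ (cong₂ ℕ._+_ (inversions-relabel-insert-one α u β hα hβ u≡±1) (neg-relabel-insert α u β hα hβ))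
                   (cong₂ ℕ._+_ (inversions-insert-one α u β hα hβ u≡±1) (neg-insert α u β)) ⟩
  I ℕ.+ length β ℕ.+ (e′ ℕ.+ N) ℕ.+ (I ℕ.+ length α ℕ.+ (e ℕ.+ N))
    ≡⟨ regroup I (length α) (length β) e e′ N ⟩
  (length α ℕ.+ length β) ℕ.+ (e′ ℕ.+ e) ℕ.+ 2 ℕ.* (I ℕ.+ N)
    ≡⟨ cong₂ (λ l s → l ℕ.+ s ℕ.+ 2 ℕ.* (I ℕ.+ N)) |α|+|β|≡m (unit-signs u≡±1) ⟩
  m ℕ.+ 1 ℕ.+ 2 ℕ.* (I ℕ.+ N)
    ≡⟨ cong (ℕ._+ 2 ℕ.* (I ℕ.+ N)) (ℕ.+-comm m 1) ⟩
  suc m ℕ.+ 2 ℕ.* (I ℕ.+ N)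
    ∎)
  where
  open ≡-Reasoning
  g : ℤ → ℤ
  g = relabel m
  exponent : List ℤ → ℕ
  exponent σ = inversions (map ∣_∣ σ) ℕ.+ neg σ
  I N e e′ : ℕ
  I = inversions (map ∣_∣ (α ++ β))
  N = neg α ℕ.+ neg β
  e = indicator (isNeg u)
  e′ = indicator (isNeg (g u))
  regroup : ∀ I a b e e′ N →
            I ℕ.+ b ℕ.+ (e′ ℕ.+ N) ℕ.+ (I ℕ.+ a ℕ.+ (e ℕ.+ N)) ≡ a ℕ.+ b ℕ.+ (e′ ℕ.+ e) ℕ.+ 2 ℕ.* (I ℕ.+ N)
  regroup = ℕ-Solver.solve-∀

isMinusOne : ℤ → Bool
isMinusOne -[1+ zero ] = true
isMinusOne _           = false

endsWithMinusOne : List ℤ → Bool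
endsWithMinusOne []          = false
endsWithMinusOne (x ∷ [])    = isMinusOne x
endsWithMinusOne (x ∷ y ∷ σ) = endsWithMinusOne (y ∷ σ)

endsWithMinusOne-++ : ∀ α u β → endsWithMinusOne (α ++ u ∷ β) ≡ endsWithMinusOne (u ∷ β)
endsWithMinusOne-++ []          u β = refl
endsWithMinusOne-++ (a ∷ [])    u β = refl
endsWithMinusOne-++ (a ∷ b ∷ α) u β = endsWithMinusOne-++ (b ∷ α) u β

fmaj-relabel-insert-one : ∀ {m} α u β → All (HighLetter m) α → All (HighLetter m) β → IsUnit u →
  endsWithMinusOne (α ++ u ∷ β) ≡ false → fmaj (map (relabel m) (α ++ u ∷ β)) ≡ suc (fmaj (α ++ u ∷ β))
fmaj-relabel-insert-one {m} α u β hα hβ (inj₁ refl) _ = begin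
  2 ℕ.* majFrom 1 (map (relabel m) σ) ℕ.+ neg (map (relabel m) σ)
    ≡⟨ cong₂ (λ a b → 2 ℕ.* a ℕ.+ b) (majFrom-relabel 1 σ (All.++⁺ (All.map high hα) (one ∷ All.map high hβ)))
                                       (neg-relabel-insert α (+ 1) β hα hβ) ⟩
  2 ℕ.* maj σ ℕ.+ suc (neg α ℕ.+ neg β)
    ≡⟨ ℕ.+-suc (2 ℕ.* maj σ) _ ⟩
  suc (2 ℕ.* maj σ ℕ.+ (neg α ℕ.+ neg β))
    ≡⟨ cong (λ n → suc (2 ℕ.* maj σ ℕ.+ n)) (neg-insert α (+ 1) β) ⟨
  suc (fmaj σ)
    ∎
  where
  open ≡-Reasoning
  σ : List ℤ
  σ = α ++ + 1 ∷ β
fmaj-relabel-insert-one α u []      hα hβ (inj₂ refl) ends≡false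
  with () ← trans (sym (endsWithMinusOne-++ α -[1+ 0 ] [])) ends≡false
fmaj-relabel-insert-one {m} α u (y ∷ β) hα hyβ (inj₂ refl) _ = begin
  2 ℕ.* majFrom 1 (map (relabel m) σ) ℕ.+ neg (map (relabel m) σ)
    ≡⟨ cong₂ (λ a b → 2 ℕ.* a ℕ.+ b) (maj-shifts α hα) (neg-relabel-insert α -[1+ 0 ] (y ∷ β) hα hyβ) ⟩
  2 ℕ.* suc (maj σ) ℕ.+ (neg α ℕ.+ neg (y ∷ β))
    ≡⟨ regroup (maj σ) (neg α ℕ.+ neg (y ∷ β)) ⟩
  suc (2 ℕ.* maj σ ℕ.+ suc (neg α ℕ.+ neg (y ∷ β)))
    ≡⟨ cong (λ n → suc (2 ℕ.* maj σ ℕ.+ n)) (neg-insert α -[1+ 0 ] (y ∷ β)) ⟨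
  suc (fmaj σ)
    ∎
  where
  open ≡-Reasoning
  σ : List ℤ
  σ = α ++ -[1+ 0 ] ∷ y ∷ β
  maj-shifts : ∀ α → All (HighLetter m) α →
               majFrom 1 (map (relabel m) (α ++ -[1+ 0 ] ∷ y ∷ β)) ≡ suc (maj (α ++ -[1+ 0 ] ∷ y ∷ β))
  maj-shifts []      _  = majFrom-relabel-minus-one-head 1 y β (All.map high hyβ)
  maj-shifts (x ∷ α) hα = majFrom-relabel-minus-one 1 x α y β (All.map high hα) (All.map high hyβ)
  regroup : ∀ M N → 2 ℕ.* suc M ℕ.+ N ≡ suc (2 ℕ.* M ℕ.+ suc N)
  regroup = ℕ-Solver.solve-∀

SignBlind : (ℤ → Set) → Set
SignBlind P = ∀ {x} → (P x → P (+ ∣ x ∣)) × (P (+ ∣ x ∣) → P x)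

All-resp-abs-↭ : ∀ {P σ τ} → SignBlind P → map ∣_∣ σ ↭ map ∣_∣ τ → All P τ → All P σ
All-resp-abs-↭ {P} blind σ↭τ Pτ = All.map (proj₂ blind)
  (All.map⁻ (↭.All-resp-↭ {P = P ∘ +_} (↭-sym σ↭τ) (All.map⁺ (All.map (proj₁ blind) Pτ))))

∈-signedPerms⇒All : ∀ {P σ} xs → SignBlind P → σ ∈ signedPerms xs → All P xs → All P σ
∈-signedPerms⇒All xs blind σ∈ = All-resp-abs-↭ blind (∈-signedPerms⇒abs-↭ xs σ∈)

high-blind : ∀ {m} → SignBlind (HighLetter m)
high-blind {x = + _}      = (λ h → h) , (λ h → h)
high-blind {x = -[1+ _ ]} = (λ { (-high a<m) → +high a<m }) , (λ { (+high a<m) → -high a<m })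

highLetters : ℕ → List ℤ
highLetters m = map (λ i → + suc i) (applyUpTo suc m)

∈-highLetters⇒ : ∀ {m τ} → τ ∈ signedPerms (highLetters m) → All (HighLetter m) τ × length τ ≡ m
∈-highLetters⇒ {m} {τ} τ∈ =
  ∈-signedPerms⇒All (highLetters m) high-blind τ∈ (All.map⁺ (All.applyUpTo⁺₁ suc m +high)) ,
  (begin
    length τ                          ≡⟨ List.length-map ∣_∣ τ ⟨
    length (map ∣_∣ τ)                ≡⟨ ↭.↭-length (∈-signedPerms⇒abs-↭ (highLetters m) τ∈) ⟩
    length (map ∣_∣ (highLetters m))  ≡⟨ List.length-map ∣_∣ (highLetters m) ⟩
    length (highLetters m)            ≡⟨ List.length-map (λ i → + suc i) (applyUpTo suc m) ⟩
    length (applyUpTo suc m)          ≡⟨ List.length-applyUpTo suc m ⟩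
    m                                 ∎)
  where open ≡-Reasoning

data UnitSplit (m : ℕ) : List ℤ → Set where
  unitSplit : ∀ α u β → IsUnit u → All (HighLetter m) α → All (HighLetter m) β →
              length α ℕ.+ length β ≡ m → UnitSplit m (α ++ u ∷ β)

∈-B-suc⇒UnitSplit : ∀ {m σ} → σ ∈ B (suc m) → UnitSplit m σ
∈-B-suc⇒UnitSplit {m} σ∈ with ∈-signedPerms-∷⁻ (+ 1) (highLetters m) σ∈
... | α , β , u , refl , u≡±1 , αβ∈ with ∈-highLetters⇒ αβ∈
... | αβ-high , |αβ|≡m = unitSplit α u β u≡±1 (All.++⁻ˡ α αβ-high) (All.++⁻ʳ α αβ-high)
  (trans (sym (List.length-++ α)) |αβ|≡m)

relabel-highLetters : ∀ m → map (relabel m) (highLetters m) ≡ idPerm m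
relabel-highLetters m = begin
  map (relabel m) (map (λ i → + suc i) (applyUpTo suc m))
    ≡⟨ cong (map (relabel m)) (List.map-applyUpTo suc (λ i → + suc i) m) ⟩
  map (relabel m) (applyUpTo (λ i → + suc (suc i)) m)
    ≡⟨ List.map-applyUpTo (λ i → + suc (suc i)) (relabel m) m ⟩
  applyUpTo (λ i → + suc i) m
    ≡⟨ List.map-applyUpTo (λ i → i) (λ i → + suc i) m ⟨
  idPerm m
    ∎
  where open ≡-Reasoning

relabel-signedPerms-high : ∀ m → map (map (relabel m)) (signedPerms (highLetters m)) ≡ B m
relabel-signedPerms-high m =
  trans (map-signedPerms (relabel m) (relabel-odd m) (highLetters m)) (cong signedPerms (relabel-highLetters m))

relabel-B-suc : ∀ m → map (map (relabel m)) (B (suc m)) ↭ B (suc m)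
relabel-B-suc m = begin
  map (map (relabel m)) (signedPerms (+ 1 ∷ highLetters m))
    ≡⟨ map-signedPerms (relabel m) (relabel-odd m) (+ 1 ∷ highLetters m) ⟩
  signedPerms (- + suc m ∷ map (relabel m) (highLetters m))
    ≡⟨ cong (λ xs → signedPerms (- + suc m ∷ xs)) (relabel-highLetters m) ⟩
  signedPerms (- + suc m ∷ idPerm m)
    ↭⟨ signedPerms-neg (+ suc m) (idPerm m) ⟩
  signedPerms (+ suc m ∷ idPerm m)
    ↭⟨ B-suc-↭ m ⟨
  B (suc m)
    ∎
  where open PermutationReasoning

-- The recurrence for the left-hand side

weight : List ℤ → ℕ → ℤ
weight σ k = χ σ * δ (fmaj σ) k

lhsCoeff : ℕ → ℕ → ℤ
lhsCoeff n k = ∑ (B n) (λ σ → weight σ k)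

coeff-lhs : ∀ n k → coeff (lhs n) k ≡ lhsCoeff n k
coeff-lhs n k = begin
  coeff (lhs n) k
    ≡⟨ coeff-Σₚ (map monomial (B n)) k ⟩
  ∑ (map monomial (B n)) (λ p → coeff p k)
    ≡⟨ ∑-map monomial (B n) (λ p → coeff p k) ⟩
  ∑ (B n) (λ σ → coeff (monomial σ) k)
    ≡⟨ ∑-cong (B n) coeff-monomial ⟩
  lhsCoeff n k
    ∎
  where
  open ≡-Reasoning
  monomial : List ℤ → Poly
  monomial σ = mono (sign n σ) (fmaj σ)
  coeff-monomial : ∀ {σ} → σ ∈ B n → coeff (monomial σ) k ≡ weight σ k
  coeff-monomial {σ} σ∈ = trans (coeff-mono (sign n σ) (fmaj σ) k) (cong (_* δ (fmaj σ) k) (sign≡χ n σ σ∈))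

∑-relabel : ∀ m (H : List ℤ → ℤ) → ∑ (B (suc m)) H ≡ ∑ (B (suc m)) (H ∘ map (relabel m))
∑-relabel m H = trans (sym (∑-↭ H (relabel-B-suc m))) (∑-map (map (relabel m)) (B (suc m)) H)

ifEndsMinusOne : (List ℤ → ℤ) → List ℤ → ℤ
ifEndsMinusOne H σ = if endsWithMinusOne σ then H σ else 0ℤ

unlessEndsMinusOne : (List ℤ → ℤ) → List ℤ → ℤ
unlessEndsMinusOne H σ = if endsWithMinusOne σ then 0ℤ else H σ

∑-split-endsMinusOne : ∀ (xs : List (List ℤ)) H →
  ∑ xs H ≡ ∑ xs (ifEndsMinusOne H) + ∑ xs (unlessEndsMinusOne H)
∑-split-endsMinusOne xs H = trans (∑-cong xs (λ {σ} _ → split σ)) (∑-+ xs (ifEndsMinusOne H) (unlessEndsMinusOne H))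
  where
  split : ∀ σ → H σ ≡ ifEndsMinusOne H σ + unlessEndsMinusOne H σ
  split σ with endsWithMinusOne σ
  ... | true  = sym (ℤ.+-identityʳ (H σ))
  ... | false = sym (ℤ.+-identityˡ (H σ))

high-not-minus-one : ∀ {m x} → HighLetter m x → isMinusOne x ≡ false
high-not-minus-one (+high _) = refl
high-not-minus-one (-high _) = refl

high-neg : ∀ {m x} → HighLetter m x → HighLetter m (- x)
high-neg (+high a<m) = -high a<m
high-neg (-high a<m) = +high a<m

endsWithMinusOne-high : ∀ {m} τ → All (HighLetter m) τ → endsWithMinusOne τ ≡ false
endsWithMinusOne-high []          []             = refl
endsWithMinusOne-high (x ∷ [])    (hx ∷ [])      = high-not-minus-one hx
endsWithMinusOne-high (x ∷ y ∷ τ) (_ ∷ hyτ)      = endsWithMinusOne-high (y ∷ τ) hyτ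

endsWithMinusOne-∷ : ∀ {z} σ → isMinusOne z ≡ false → endsWithMinusOne (z ∷ σ) ≡ endsWithMinusOne σ
endsWithMinusOne-∷ []      z≢-1 = z≢-1
endsWithMinusOne-∷ (y ∷ σ) z≢-1 = refl

∑-endsMinusOne-insertions : ∀ {m} q → All (HighLetter m) q → ∀ (H : List ℤ → ℤ) →
  ∑ (concatMap signings (insertions (+ 1) q)) (ifEndsMinusOne H) ≡ ∑ (signings q) (λ τ → H (τ ∷ʳ -[1+ 0 ]))
∑-endsMinusOne-insertions []      []          H = ℤ.+-identityˡ _
∑-endsMinusOne-insertions {m} (z ∷ q) (hz ∷ hq) H = begin
  ∑ (signings (+ 1 ∷ z ∷ q) ++ concatMap signings (map (z ∷_) W)) (ifEndsMinusOne H)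
    ≡⟨ ∑-++ (signings (+ 1 ∷ z ∷ q)) _ (ifEndsMinusOne H) ⟩
  ∑ (signings (+ 1 ∷ z ∷ q)) (ifEndsMinusOne H) + ∑ (concatMap signings (map (z ∷_) W)) (ifEndsMinusOne H)
    ≡⟨ cong₂ _+_ (∑-zero (signings (+ 1 ∷ z ∷ q)) not-ending)
                 (cong (λ xs → ∑ xs (ifEndsMinusOne H)) (signings-∷ z W)) ⟩
  0ℤ + ∑ (concatMap (bothSigns z) X) (ifEndsMinusOne H)
    ≡⟨ trans (ℤ.+-identityˡ _) (∑-concatMap (bothSigns z) X (ifEndsMinusOne H)) ⟩
  ∑ X (λ x → ifEndsMinusOne H (z ∷ x) + (ifEndsMinusOne H (- z ∷ x) + 0ℤ))
    ≡⟨ ∑-cong X (λ {x} _ → cong₂ _+_ (drop-head z hz x)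
                                     (trans (ℤ.+-identityʳ _) (drop-head (- z) (high-neg hz) x))) ⟩
  ∑ X (λ x → ifEndsMinusOne (H ∘ (z ∷_)) x + ifEndsMinusOne (H ∘ (- z ∷_)) x)
    ≡⟨ ∑-+ X (ifEndsMinusOne (H ∘ (z ∷_))) (ifEndsMinusOne (H ∘ (- z ∷_))) ⟩
  ∑ X (ifEndsMinusOne (H ∘ (z ∷_))) + ∑ X (ifEndsMinusOne (H ∘ (- z ∷_)))
    ≡⟨ cong₂ _+_ (∑-endsMinusOne-insertions q hq (H ∘ (z ∷_)))
                 (∑-endsMinusOne-insertions q hq (H ∘ (- z ∷_))) ⟩
  ∑ (signings q) (λ τ → H (z ∷ τ ∷ʳ -[1+ 0 ])) + ∑ (signings q) (λ τ → H (- z ∷ τ ∷ʳ -[1+ 0 ]))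
    ≡⟨ ∑-+ (signings q) _ _ ⟨
  ∑ (signings q) (λ τ → H (z ∷ τ ∷ʳ -[1+ 0 ]) + H (- z ∷ τ ∷ʳ -[1+ 0 ]))
    ≡⟨ ∑-cong (signings q) (λ {τ} _ → cong (_+_ (H (z ∷ τ ∷ʳ -[1+ 0 ]))) (sym (ℤ.+-identityʳ _))) ⟩
  ∑ (signings q) (λ τ → ∑ (bothSigns z τ) (λ τ → H (τ ∷ʳ -[1+ 0 ])))
    ≡⟨ ∑-concatMap (bothSigns z) (signings q) (λ τ → H (τ ∷ʳ -[1+ 0 ])) ⟨
  ∑ (signings (z ∷ q)) (λ τ → H (τ ∷ʳ -[1+ 0 ]))
    ∎
  where
  open ≡-Reasoning
  W X : List (List ℤ)
  W = insertions (+ 1) q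
  X = concatMap signings W
  drop-head : ∀ z → HighLetter m z → ∀ x → ifEndsMinusOne H (z ∷ x) ≡ ifEndsMinusOne (H ∘ (z ∷_)) x
  drop-head z hz x = cong (λ b → if b then H (z ∷ x) else 0ℤ) (endsWithMinusOne-∷ x (high-not-minus-one hz))
  not-ending : ∀ {σ} → σ ∈ signings (+ 1 ∷ z ∷ q) → ifEndsMinusOne H σ ≡ 0ℤ
  not-ending {σ} σ∈ with σ | ∈-signings⇒abs (+ 1 ∷ z ∷ q) σ∈
  ... | a ∷ b ∷ τ | abs≡ = cong (λ e → if e then H (a ∷ b ∷ τ) else 0ℤ)
    (endsWithMinusOne-high (b ∷ τ) (All-resp-abs-↭ high-blind (↭-reflexive (List.∷-injectiveʳ abs≡)) (hz ∷ hq)))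

∑-endsMinusOne-B-suc : ∀ m (H : List ℤ → ℤ) →
  ∑ (B (suc m)) (ifEndsMinusOne H) ≡ ∑ (signedPerms (highLetters m)) (λ τ → H (τ ∷ʳ -[1+ 0 ]))
∑-endsMinusOne-B-suc m H = begin
  ∑ (concatMap signings (concatMap (insertions (+ 1)) (perms hl))) (ifEndsMinusOne H)
    ≡⟨ cong (λ xs → ∑ xs (ifEndsMinusOne H)) (concatMap-concatMap signings (insertions (+ 1)) (perms hl)) ⟩
  ∑ (concatMap (λ p → concatMap signings (insertions (+ 1) p)) (perms hl)) (ifEndsMinusOne H)
    ≡⟨ ∑-concatMap (λ p → concatMap signings (insertions (+ 1) p)) (perms hl) (ifEndsMinusOne H) ⟩
  ∑ (perms hl) (λ p → ∑ (concatMap signings (insertions (+ 1) p)) (ifEndsMinusOne H))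
    ≡⟨ ∑-cong (perms hl) (λ {p} p∈ → ∑-endsMinusOne-insertions p (high-perm p∈) H) ⟩
  ∑ (perms hl) (λ p → ∑ (signings p) (λ τ → H (τ ∷ʳ -[1+ 0 ])))
    ≡⟨ ∑-concatMap signings (perms hl) (λ τ → H (τ ∷ʳ -[1+ 0 ])) ⟨
  ∑ (signedPerms hl) (λ τ → H (τ ∷ʳ -[1+ 0 ]))
    ∎
  where
  open ≡-Reasoning
  hl : List ℤ
  hl = highLetters m
  high-perm : ∀ {p} → p ∈ perms hl → All (HighLetter m) p
  high-perm p∈ = ↭.All-resp-↭ (↭-sym (∈-perms⇒↭ hl p∈)) (All.map⁺ (All.applyUpTo⁺₁ suc m +high))

∑-endsMinusOne-relabel : ∀ m k →
  ∑ (B (suc m)) (ifEndsMinusOne (λ σ → weight (map (relabel m) σ) k)) ≡ lhsCoeff m k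
∑-endsMinusOne-relabel m k = begin
  ∑ (B (suc m)) (ifEndsMinusOne (λ σ → weight (map g σ) k))
    ≡⟨ ∑-endsMinusOne-B-suc m (λ σ → weight (map g σ) k) ⟩
  ∑ (signedPerms (highLetters m)) (λ τ → weight (map g (τ ∷ʳ -[1+ 0 ])) k)
    ≡⟨ ∑-cong (signedPerms (highLetters m)) (λ τ∈ → drop-top (proj₁ (∈-highLetters⇒ τ∈))) ⟩
  ∑ (signedPerms (highLetters m)) (λ τ → weight (map g τ) k)
    ≡⟨ ∑-map (map g) (signedPerms (highLetters m)) (λ ρ → weight ρ k) ⟨
  ∑ (map (map g) (signedPerms (highLetters m))) (λ ρ → weight ρ k)
    ≡⟨ cong (λ xs → ∑ xs (λ ρ → weight ρ k)) (relabel-signedPerms-high m) ⟩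
  lhsCoeff m k
    ∎
  where
  open ≡-Reasoning
  g : ℤ → ℤ
  g = relabel m
  drop-top : ∀ {τ} → All (HighLetter m) τ → weight (map g (τ ∷ʳ -[1+ 0 ])) k ≡ weight (map g τ) k
  drop-top {τ} hτ = trans (cong (λ ρ → weight ρ k) (List.map-++ g τ [ -[1+ 0 ] ]))
    (cong₂ (λ c f → c * δ f k) (χ-∷ʳ-top (map g τ) (relabel-highs hτ)) (fmaj-∷ʳ-top (map g τ) (relabel-highs hτ)))

∑-endsMinusOne : ∀ m k →
  ∑ (B (suc m)) (ifEndsMinusOne (λ σ → weight σ k)) ≡ negOnePow (suc m) * shift (2 ℕ.* m ℕ.+ 1) (lhsCoeff m) k
∑-endsMinusOne m k = begin
  ∑ (B (suc m)) (ifEndsMinusOne (λ σ → weight σ k))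
    ≡⟨ ∑-endsMinusOne-B-suc m (λ σ → weight σ k) ⟩
  ∑ (signedPerms (highLetters m)) (λ τ → weight (τ ∷ʳ -[1+ 0 ]) k)
    ≡⟨ ∑-cong (signedPerms (highLetters m)) (λ τ∈ → append-minus-one (∈-highLetters⇒ τ∈)) ⟩
  ∑ (signedPerms (highLetters m)) (λ τ → s * shift d (weight (map g τ)) k)
    ≡⟨ ∑-*ˡ (signedPerms (highLetters m)) s (λ τ → shift d (weight (map g τ)) k) ⟩
  s * ∑ (signedPerms (highLetters m)) (λ τ → shift d (weight (map g τ)) k)
    ≡⟨ cong (s *_) (∑-shift (signedPerms (highLetters m)) d (weight ∘ map g) k) ⟩
  s * shift d (λ j → ∑ (signedPerms (highLetters m)) (λ τ → weight (map g τ) j)) k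
    ≡⟨ cong (s *_) (shift-cong d (λ j → trans (sym (∑-map (map g) (signedPerms (highLetters m)) (λ ρ → weight ρ j)))
                                             (cong (λ xs → ∑ xs (λ ρ → weight ρ j)) (relabel-signedPerms-high m))) k) ⟩
  s * shift d (lhsCoeff m) k
    ∎
  where
  open ≡-Reasoning
  g : ℤ → ℤ
  g = relabel m
  s : ℤ
  s = negOnePow (suc m)
  d : ℕ
  d = 2 ℕ.* m ℕ.+ 1
  append-minus-one : ∀ {τ} → All (HighLetter m) τ × length τ ≡ m →
                     weight (τ ∷ʳ -[1+ 0 ]) k ≡ s * shift d (weight (map g τ)) k
  append-minus-one {τ} (hτ , |τ|≡m) = begin
    χ (τ ∷ʳ -[1+ 0 ]) * δ (fmaj (τ ∷ʳ -[1+ 0 ])) k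
      ≡⟨ cong₂ (λ c f → c * δ f k) (χ-∷ʳ-minus-one τ hτ |τ|≡m) (fmaj-∷ʳ-minus-one τ hτ |τ|≡m) ⟩
    s * χ τ * δ (d ℕ.+ fmaj τ) k
      ≡⟨ cong₂ (λ c f → s * c * δ (d ℕ.+ f) k) (χ-relabel-high τ hτ) (fmaj-relabel-high τ hτ) ⟨
    s * χ (map g τ) * δ (d ℕ.+ fmaj (map g τ)) k
      ≡⟨ cong (s * χ (map g τ) *_) (δ-+ d (fmaj (map g τ)) k) ⟩
    s * χ (map g τ) * shift d (δ (fmaj (map g τ))) k
      ≡⟨ ℤ.*-assoc s (χ (map g τ)) _ ⟩
    s * (χ (map g τ) * shift d (δ (fmaj (map g τ))) k)
      ≡⟨ cong (s *_) (shift-*ˡ d (χ (map g τ)) (δ (fmaj (map g τ))) k) ⟨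
    s * shift d (weight (map g τ)) k
      ∎

notEndingCoeff : ℕ → ℕ → ℤ
notEndingCoeff m j = ∑ (B (suc m)) (unlessEndsMinusOne (λ σ → weight σ j))

∑-notEndsMinusOne-relabel : ∀ m k →
  ∑ (B (suc m)) (unlessEndsMinusOne (λ σ → weight (map (relabel m) σ) k)) ≡
  negOnePow (suc m) * shift 1 (notEndingCoeff m) k
∑-notEndsMinusOne-relabel m k = begin
  ∑ (B (suc m)) (unlessEndsMinusOne (λ σ → weight (map g σ) k))
    ≡⟨ ∑-cong (B (suc m)) (λ {σ} σ∈ → relabel-step σ (∈-B-suc⇒UnitSplit σ∈)) ⟩
  ∑ (B (suc m)) (λ σ → s * shift 1 (λ j → unlessEndsMinusOne (λ σ → weight σ j) σ) k)
    ≡⟨ ∑-*ˡ (B (suc m)) s (λ σ → shift 1 (λ j → unlessEndsMinusOne (λ σ → weight σ j) σ) k) ⟩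
  s * ∑ (B (suc m)) (λ σ → shift 1 (λ j → unlessEndsMinusOne (λ σ → weight σ j) σ) k)
    ≡⟨ cong (s *_) (∑-shift (B (suc m)) 1 (λ σ j → unlessEndsMinusOne (λ σ → weight σ j) σ) k) ⟩
  s * shift 1 (λ j → ∑ (B (suc m)) (unlessEndsMinusOne (λ σ → weight σ j))) k
    ∎
  where
  open ≡-Reasoning
  g : ℤ → ℤ
  g = relabel m
  s : ℤ
  s = negOnePow (suc m)
  relabel-step : ∀ σ → UnitSplit m σ →
    unlessEndsMinusOne (λ σ → weight (map g σ) k) σ ≡ s * shift 1 (λ j → unlessEndsMinusOne (λ σ → weight σ j) σ) k
  relabel-step σ split with endsWithMinusOne σ in ends
  ... | true  = sym (trans (cong (s *_) (shift-*ˡ 1 0ℤ (λ _ → 0ℤ) k)) (ℤ.*-zeroʳ s))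
  relabel-step _ (unitSplit α u β u≡±1 α-high β-high |α|+|β|≡m) | false = begin
    χ (map g σ) * δ (fmaj (map g σ)) k
      ≡⟨ cong₂ (λ c f → c * δ f k) (χ-relabel-insert-one α u β α-high β-high |α|+|β|≡m u≡±1)
                                   (fmaj-relabel-insert-one α u β α-high β-high u≡±1 ends) ⟩
    s * χ σ * δ (1 ℕ.+ fmaj σ) k
      ≡⟨ trans (ℤ.*-assoc s (χ σ) _) (cong (λ x → s * (χ σ * x)) (δ-+ 1 (fmaj σ) k)) ⟩
    s * (χ σ * shift 1 (δ (fmaj σ)) k)
      ≡⟨ cong (s *_) (shift-*ˡ 1 (χ σ) (δ (fmaj σ)) k) ⟨
    s * shift 1 (weight σ) k
      ∎
    where
    σ : List ℤ
    σ = α ++ u ∷ β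

lhsCoeff-suc-relabelled : ∀ m j →
  lhsCoeff (suc m) j ≡ lhsCoeff m j + negOnePow (suc m) * shift 1 (notEndingCoeff m) j
lhsCoeff-suc-relabelled m j = begin
  lhsCoeff (suc m) j
    ≡⟨ ∑-relabel m (λ σ → weight σ j) ⟩
  ∑ (B (suc m)) (λ σ → weight (map (relabel m) σ) j)
    ≡⟨ ∑-split-endsMinusOne (B (suc m)) (λ σ → weight (map (relabel m) σ) j) ⟩
  ∑ (B (suc m)) (ifEndsMinusOne (λ σ → weight (map (relabel m) σ) j)) +
  ∑ (B (suc m)) (unlessEndsMinusOne (λ σ → weight (map (relabel m) σ) j))
    ≡⟨ cong₂ _+_ (∑-endsMinusOne-relabel m j) (∑-notEndsMinusOne-relabel m j) ⟩
  lhsCoeff m j + negOnePow (suc m) * shift 1 (notEndingCoeff m) j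
    ∎
  where open ≡-Reasoning

lhsCoeff-suc-split : ∀ m j →
  lhsCoeff (suc m) j ≡ negOnePow (suc m) * shift (2 ℕ.* m ℕ.+ 1) (lhsCoeff m) j + notEndingCoeff m j
lhsCoeff-suc-split m j = trans (∑-split-endsMinusOne (B (suc m)) (λ σ → weight σ j))
  (cong (_+ notEndingCoeff m j) (∑-endsMinusOne m j))

lhsCoeff-recurrence : ∀ m k → lhsCoeff (suc m) k - negOnePow (suc m) * shift 1 (lhsCoeff (suc m)) k
                            ≡ lhsCoeff m k - 1ℤ * shift (2 ℕ.* suc m) (lhsCoeff m) k
lhsCoeff-recurrence m zero    = begin
  lhsCoeff (suc m) 0 - s * 0ℤ
    ≡⟨ cong (λ x → x - s * 0ℤ) (lhsCoeff-suc-relabelled m 0) ⟩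
  lhsCoeff m 0 + s * 0ℤ - s * 0ℤ
    ≡⟨ cancel (lhsCoeff m 0) s ⟩
  lhsCoeff m 0 - 1ℤ * 0ℤ
    ∎
  where
  open ≡-Reasoning
  s : ℤ
  s = negOnePow (suc m)
  cancel : ∀ a s → a + s * 0ℤ - s * 0ℤ ≡ a - 1ℤ * 0ℤ
  cancel = solve-∀
lhsCoeff-recurrence m (suc j) = begin
  lhsCoeff (suc m) (suc j) - s * lhsCoeff (suc m) j
    ≡⟨ cong₂ (λ x y → x - s * y) (lhsCoeff-suc-relabelled m (suc j)) (lhsCoeff-suc-split m j) ⟩
  lhsCoeff m (suc j) + s * N - s * (s * X + N)
    ≡⟨ cancel (lhsCoeff m (suc j)) s N X ⟩
  lhsCoeff m (suc j) - s * s * X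
    ≡⟨ cong (λ c → lhsCoeff m (suc j) - c * X) (negOnePow-square (suc m)) ⟩
  lhsCoeff m (suc j) - 1ℤ * X
    ≡⟨ cong (λ d → lhsCoeff m (suc j) - 1ℤ * shift d (lhsCoeff m) j) (exponent m) ⟩
  lhsCoeff m (suc j) - 1ℤ * shift (2 ℕ.* suc m) (lhsCoeff m) (suc j)
    ∎
  where
  open ≡-Reasoning
  s X N : ℤ
  s = negOnePow (suc m)
  X = shift (2 ℕ.* m ℕ.+ 1) (lhsCoeff m) j
  N = notEndingCoeff m j
  cancel : ∀ a s n x → a + s * n - s * (s * x + n) ≡ a - s * s * x
  cancel = solve-∀
  exponent : ∀ m → 2 ℕ.* m ℕ.+ 1 ≡ m ℕ.+ suc (m ℕ.+ 0)
  exponent = ℕ-Solver.solve-∀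

lhs-recurrence : ∀ m →
  one-minus (negOnePow (suc m)) 1 ⊛ lhs (suc m) ≈ₚ one-minus 1ℤ (2 ℕ.* suc m) ⊛ lhs m
lhs-recurrence m k = begin
  coeff (one-minus s 1 ⊛ lhs (suc m)) k
    ≡⟨ coeff-one-minus-⊛ s 1 (lhs (suc m)) k ⟩
  coeff (lhs (suc m)) k - s * shift 1 (coeff (lhs (suc m))) k
    ≡⟨ cong₂ (λ x y → x - s * y) (coeff-lhs (suc m) k) (shift-cong 1 (coeff-lhs (suc m)) k) ⟩
  lhsCoeff (suc m) k - s * shift 1 (lhsCoeff (suc m)) k
    ≡⟨ lhsCoeff-recurrence m k ⟩
  lhsCoeff m k - 1ℤ * shift (2 ℕ.* suc m) (lhsCoeff m) k
    ≡⟨ cong₂ (λ x y → x - 1ℤ * y) (coeff-lhs m k) (shift-cong (2 ℕ.* suc m) (coeff-lhs m) k) ⟨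
  coeff (lhs m) k - 1ℤ * shift (2 ℕ.* suc m) (coeff (lhs m)) k
    ≡⟨ coeff-one-minus-⊛ 1ℤ (2 ℕ.* suc m) (lhs m) k ⟨
  coeff (one-minus 1ℤ (2 ℕ.* suc m) ⊛ lhs m) k
    ∎
  where
  open ≡-Reasoning
  s : ℤ
  s = negOnePow (suc m)

lhs≈rhs : ∀ n → lhs n ≈ₚ rhs n
lhs≈rhs zero    zero    = refl
lhs≈rhs zero    (suc k) = refl
lhs≈rhs (suc m) = one-minus-cancelˡ (negOnePow (suc m)) (lhs (suc m)) (rhs (suc m)) (begin
  one-minus (negOnePow (suc m)) 1 ⊛ lhs (suc m)
    ≈⟨ lhs-recurrence m ⟩
  one-minus 1ℤ (2 ℕ.* suc m) ⊛ lhs m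
    ≈⟨ ⊛-congʳ (one-minus 1ℤ (2 ℕ.* suc m)) (lhs m) (rhs m) (lhs≈rhs m) ⟩
  one-minus 1ℤ (2 ℕ.* suc m) ⊛ rhs m
    ≈⟨ rhs-recurrence m ⟨
  one-minus (negOnePow (suc m)) 1 ⊛ rhs (suc m)
    ∎)
  where open ≈ₚ-Reasoning

-- The identity holds for n = 0 as well.
theorem5p1 : (n : ℕ) → 1 ≤ n → lhs n ≈ₚ rhs n
theorem5p1 n _ = lhs≈rhs n
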